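{- Let $P$ be a set of (non-empty) permutations and $n\ge0$. Then the staircase encoding $\mathrm{SE}$ is a bijection between $\mathrm{Av}^{(n)}(2413,3142,2314,3124,1\oplus P)$ and $\mathrm{WI}(\mathcal{UDRC}(B_n),\mathrm{Av}^{+}(2413,3142,2314,3124,P))$.
   Context: A permutation of size $n$ is a word containing each of $1,\dots,n$ exactly once. $\sigma$ contains $\pi$ if some subsequence of $\sigma$ has the same relative order as $\pi$; otherwise it avoids $\pi$. $\mathrm{Av}(P)$ is the set of permutations avoiding every element of $P$, $\mathrm{Av}^{+}(P)$ its non-empty elements. $1\oplus\pi$ is the permutation $1(\pi_1+1)\cdots(\pi_m+1)$ and $1\oplus P=\{1\oplus\pi:\pi\in P\}$. The empty permutation is not in $P$. A left-to-right minimum of $\sigma$ is an entry $\sigma_i$ with $\sigma_j>\sigma_i$ for all $j<i$; $\mathrm{Av}^{(n)}(Q)$ is the set of permutations in $\mathrm{Av}(Q)$ with exactly $n$ left-to-right minima. $B_n=\{(i,j):1\le i\le j\le n\}$ (row $i$, column $j$, row 1 on top). If $\sigma$ has left-to-right minima at positions $p_1<\dots<p_n$ with values $v_1>\dots>v_n$, each non-minimum entry $\sigma_k$ lies in cell $(i,j)$ where $j$ is the largest index with $p_j<k$ and $i$ the smallest index with $v_i<\sigma_k$. $\mathrm{SE}(\sigma)$ is the filling of $B_n$ putting in each cell the standardization of the entries of $\sigma$ in that cell (empty permutation if none). $\mathcal{UDRC}(B_n)$ is the graph on $B_n$ in which $(i,j)\ne(k,\ell)$ are adjacent iff at least one of: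 (up) $i>k$ and $j<\ell$ (or symmetrically); (down) $i<k$, $j<\ell$ and $\{i,\dots,k\}\times\{j,\dots,\ell\}\subseteq B_n$ (or symmetrically); (row) $i=k$; (column) $j=\ell$. For a graph $G$ on $B_n$ and a set $S$ of non-empty permutations, $\mathrm{WI}(G,S)$ is the set of fillings of $B_n$ whose non-empty cells form an independent set of $G$ and all contain elements of $S$. "SE is a bijection between $X$ and $Y$" means SE restricted to $X$ is injective with image exactly $Y$. -}

module Defs where

open import Data.Bool using (Bool; true; false; if_then_else_; _∧_)
open import Data.Nat using (ℕ; zero; suc; _<_; _≤_; _<ᵇ_; _≡ᵇ_)
open import Data.List using (List; []; _∷_; _++_; [_]; map; filterᵇ; length; upTo; zip)
open import Data.Maybe using (Maybe; just; nothing)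
open import Data.Product using (_×_; _,_; ∃; proj₁; proj₂)
open import Data.Sum using (_⊎_)
open import Data.Empty using (⊥)
open import Relation.Nullary using (¬_)
open import Relation.Binary.PropositionalEquality using (_≡_)
open import Function.Bundles using (_⇔_)
open import Data.List.Relation.Binary.Pointwise using (Pointwise)
open import Data.List.Relation.Binary.Sublist.Propositional using (_⊆_)
open import Data.List.Relation.Binary.Permutation.Propositional using (_↭_)

Word : Set
Word = List ℕ

IsPerm : Word → Set
IsPerm σ = σ ↭ map suc (upTo (length σ))

data SameOrder : Word → Word → Set where
  []  : SameOrder [] []
  _∷_ : ∀ {a b u v} →
        Pointwise (λ x y → ((x < a) ⇔ (y < b)) × ((a < x) ⇔ (b < y))) u v →
        SameOrder u v → SameOrder (a ∷ u) (b ∷ v)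

Contains : Word → Word → Set
Contains σ π = ∃ λ w → (w ⊆ σ) × SameOrder w π

PermSet : Set₁
PermSet = Word → Set

Av : PermSet → Word → Set
Av Q σ = IsPerm σ × (∀ π → Q π → ¬ Contains σ π)

Av⁺ : PermSet → Word → Set
Av⁺ Q σ = Av Q σ × ¬ (σ ≡ [])

1⊕ : Word → Word
1⊕ π = 1 ∷ map suc π

1⊕Set : PermSet → PermSet
1⊕Set P π = ∃ λ τ → P τ × π ≡ 1⊕ τ

_∪_ : PermSet → PermSet → PermSet
(Q ∪ R) π = Q π ⊎ R π

Basis4 : PermSet
Basis4 π = (π ≡ 2 ∷ 4 ∷ 1 ∷ 3 ∷ []) ⊎ (π ≡ 3 ∷ 1 ∷ 4 ∷ 2 ∷ [])
         ⊎ (π ≡ 2 ∷ 3 ∷ 1 ∷ 4 ∷ []) ⊎ (π ≡ 3 ∷ 1 ∷ 2 ∷ 4 ∷ [])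

isLTRmin : Word → ℕ → Bool
isLTRmin []        x = true
isLTRmin (y ∷ pre) x = (x <ᵇ y) ∧ isLTRmin pre x

ltrFlags′ : Word → Word → List Bool
ltrFlags′ pre []       = []
ltrFlags′ pre (x ∷ xs) = isLTRmin pre x ∷ ltrFlags′ (pre ++ [ x ]) xs

ltrFlags : Word → List Bool
ltrFlags = ltrFlags′ []

ltrMinValues : Word → List ℕ
ltrMinValues σ = map proj₂ (filterᵇ proj₁ (zip (ltrFlags σ) σ))

ltrCount : Word → ℕ
ltrCount σ = length (ltrMinValues σ)

AvN : ℕ → PermSet → Word → Set
AvN n Q σ = Av Q σ × ltrCount σ ≡ n

firstBelow : List ℕ → ℕ → ℕ
firstBelow []       x = 1
firstBelow (v ∷ vs) x = if v <ᵇ x then 1 else suc (firstBelow vs x)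

-- For each entry: nothing if it is a left-to-right minimum, otherwise
-- just (i , j) = its cell: j = number of LTR minima strictly before it
-- (= largest j with p_j < k), i = smallest index with vᵢ < entry.
cellLabels′ : List ℕ → ℕ → Word → Word → List (Maybe (ℕ × ℕ))
cellLabels′ ms c pre []       = []
cellLabels′ ms c pre (x ∷ xs) =
  if isLTRmin pre x
  then nothing ∷ cellLabels′ ms (suc c) (pre ++ [ x ]) xs
  else just (firstBelow ms x , c) ∷ cellLabels′ ms c (pre ++ [ x ]) xs

cellLabels : Word → List (Maybe (ℕ × ℕ))
cellLabels σ = cellLabels′ (ltrMinValues σ) 0 [] σ

isCell : ℕ → ℕ → Maybe (ℕ × ℕ) → Bool
isCell i j nothing          = false
isCell i j (just (i′ , j′)) = (i ≡ᵇ i′) ∧ (j ≡ᵇ j′)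

cellEntries : Word → ℕ → ℕ → Word
cellEntries σ i j = map proj₂ (filterᵇ (λ p → isCell i j (proj₁ p)) (zip (cellLabels σ) σ))

-- standardization (for words with distinct entries)
st : Word → Word
st w = map (λ x → suc (length (filterᵇ (λ y → y <ᵇ x) w))) w

-- A filling assigns a word to each cell (i , j) (row i, column j, 1-based);
-- only the cells of Bₙ are relevant.
Filling : Set
Filling = ℕ → ℕ → Word

SE : Word → Filling
SE σ i j = st (cellEntries σ i j)

InB : ℕ → ℕ → ℕ → Set
InB n i j = (1 ≤ i) × (i ≤ j) × (j ≤ n)

_≈[_]_ : Filling → ℕ → Filling → Set
F ≈[ n ] G = ∀ i j → InB n i j → F i j ≡ G i j

Graph : Set₁
Graph = ℕ → ℕ → ℕ → ℕ → Set

RectIn : ℕ → ℕ → ℕ → ℕ → ℕ → Set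
RectIn n i j k ℓ = ∀ a b → i ≤ a → a ≤ k → j ≤ b → b ≤ ℓ → InB n a b

UDRC : ℕ → Graph
UDRC n i j k ℓ =
  ¬ ((i ≡ k) × (j ≡ ℓ)) ×
  ( (((k < i) × (j < ℓ)) ⊎ ((i < k) × (ℓ < j)))                            -- up
  ⊎ (((i < k) × (j < ℓ) × RectIn n i j k ℓ)
     ⊎ ((k < i) × (ℓ < j) × RectIn n k ℓ i j))                             -- down
  ⊎ (i ≡ k)                                                                -- row
  ⊎ (j ≡ ℓ))                                                               -- column

WI : ℕ → Graph → PermSet → Filling → Set
WI n G S F =
  (∀ i j → InB n i j → ¬ (F i j ≡ []) → S (F i j)) ×
  (∀ i j k ℓ → InB n i j → InB n k ℓ → ¬ (F i j ≡ []) → ¬ (F k ℓ ≡ []) → ¬ G i j k ℓ)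

SEBijection : ℕ → PermSet → (Filling → Set) → Set
SEBijection n X Y =
  (∀ σ τ → X σ → X τ → SE σ ≈[ n ] SE τ → σ ≡ τ) ×
  (∀ σ → X σ → Y (SE σ)) ×
  (∀ F → Y F → ∃ λ σ → X σ × SE σ ≈[ n ] F)

-- A permutation avoiding 2413, 3142, 2314 and 3124 is a skew sum of blocks, each a decreasing run of left-to-right
-- minima followed by a permutation α lying above the run: the first entry a is followed by entries below a, then
-- entries above a, and by 3124 the former are decreasing while by 2314, 2413 and 3142 everything after lies below
-- all of them. SE puts the α of a block with L + 1 minima, preceded by c minima, into cell (c + 1 , c + L + 1) and
-- leaves all other cells empty, and these are exactly the independent fillings of UDRC(Bₙ): a non-empty cell is
-- adjacent to every other cell of its rows. The basis patterns and 1 ⊕ τ are skew indecomposable, so they occur in a block word only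
-- inside one block, and 1 ⊕ τ occurs in a block exactly when τ occurs in its α, taking the last minimum for the 1.

module Submission where

open import Defs
open import Data.Nat using (ℕ)
open import Data.List using ([])
open import Relation.Nullary using (¬_)

open import Data.Bool using (Bool; true; false; if_then_else_; _∧_; T)
open import Data.Empty using (⊥; ⊥-elim)
open import Data.List using (List; _∷_; _++_; [_]; map; filter; filterᵇ; length; upTo; applyUpTo; zip; replicate)
import Data.List.Properties as Listₚ
open import Data.List.Membership.Propositional using (_∈_)
import Data.List.Membership.Propositional.Properties as ∈ₚ
open import Data.List.Relation.Binary.Permutation.Propositional using (_↭_; ↭-refl; ↭-sym; ↭-trans; ↭-reflexive; prep; ↭⇒↭ₛ)
import Data.List.Relation.Binary.Permutation.Propositional.Properties as ↭ₚ
open import Data.List.Relation.Binary.Pointwise as Pointwise using (Pointwise; []; _∷_)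
open import Data.List.Relation.Binary.Sublist.Propositional using (_⊆_; []; _∷_; _∷ʳ_; ⊆-refl; ⊆-trans; from∈; minimum)
import Data.List.Relation.Binary.Sublist.Propositional.Properties as ⊆ₚ
open import Data.List.Relation.Unary.All as All using (All; []; _∷_)
import Data.List.Relation.Unary.All.Properties as Allₚ
open import Data.List.Relation.Unary.AllPairs as AllPairs using (AllPairs; []; _∷_; allPairs?)
open import Data.List.Relation.Unary.Any using (here; there)
open import Data.List.Relation.Unary.Unique.Propositional using (Unique)
open import Data.Maybe using (Maybe; just; nothing; is-nothing)
open import Data.Nat using (zero; suc; _+_; _∸_; _<_; _≤_; _>_; _<ᵇ_; _≡ᵇ_; z≤n; s≤s; z<s; _≟_; _<?_; _>?_)
import Data.Nat.Properties as ℕₚ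
open import Data.Product using (_×_; _,_; ∃; ∃₂; proj₁; proj₂)
open import Data.Sum using (_⊎_; inj₁; inj₂)
open import Function using (_∘_)
open import Function.Bundles using (_⇔_; mk⇔; Equivalence)
import Function.Properties.Equivalence as ⇔
open import Level using (0ℓ)
open import Relation.Binary.Definitions using (tri<; tri≈; tri>)
import Relation.Binary.PropositionalEquality as ≡
open import Relation.Binary.PropositionalEquality using (_≡_; _≢_; refl; sym; trans; cong; cong₂; subst; subst₂; module ≡-Reasoning)
open import Data.List.Relation.Binary.Permutation.Setoid.Properties (≡.setoid ℕ) using (Unique-resp-↭)
open import Relation.Nullary using (Dec; yes; no; contradiction)
open import Relation.Nullary.Decidable using (¬?; T?; _×-dec_; decidable-stable; False; toWitnessFalse)
open import Relation.Unary using (Pred; Decidable)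

<⇒<ᵇ≡true : ∀ {m n} → m < n → (m <ᵇ n) ≡ true
<⇒<ᵇ≡true {m} {n} m<n with m <ᵇ n | ℕₚ.<⇒<ᵇ m<n
... | true | _ = refl

≮⇒<ᵇ≡false : ∀ {m n} → ¬ m < n → (m <ᵇ n) ≡ false
≮⇒<ᵇ≡false {m} {n} m≮n with m <ᵇ n in eq
... | false = refl
... | true  = ⊥-elim (m≮n (ℕₚ.<ᵇ⇒< m n (subst T (sym eq) _)))

<ᵇ≡true⇒< : ∀ {m n} → (m <ᵇ n) ≡ true → m < n
<ᵇ≡true⇒< {m} {n} eq = ℕₚ.<ᵇ⇒< m n (subst T (sym eq) _)

≡ᵇ-refl : ∀ n → (n ≡ᵇ n) ≡ true
≡ᵇ-refl zero    = refl
≡ᵇ-refl (suc n) = ≡ᵇ-refl n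

≢⇒≡ᵇ≡false : ∀ {m n} → m ≢ n → (m ≡ᵇ n) ≡ false
≢⇒≡ᵇ≡false {m} {n} m≢n with m ≡ᵇ n in eq
... | false = refl
... | true  = ⊥-elim (m≢n (ℕₚ.≡ᵇ⇒≡ m n (subst T (sym eq) _)))

≡ᵇ≡true⇒≡ : ∀ {m n} → (m ≡ᵇ n) ≡ true → m ≡ n
≡ᵇ≡true⇒≡ {m} {n} eq = ℕₚ.≡ᵇ⇒≡ m n (subst T (sym eq) _)

∧≡true⇒ : ∀ {a b} → (a ∧ b) ≡ true → a ≡ true × b ≡ true
∧≡true⇒ {true} eq = refl , eq

interval : ℕ → ℕ → List ℕ
interval b zero    = []
interval b (suc k) = suc b ∷ interval (suc b) k

descending : ℕ → ℕ → List ℕ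
descending b zero    = []
descending b (suc k) = b + suc k ∷ descending b k

map-suc-applyUpTo : ∀ (f : ℕ → ℕ) b k → (∀ i → f i ≡ b + i) → map suc (applyUpTo f k) ≡ interval b k
map-suc-applyUpTo f b zero    f≗b+ = refl
map-suc-applyUpTo f b (suc k) f≗b+ =
  cong₂ _∷_ (cong suc (trans (f≗b+ 0) (ℕₚ.+-identityʳ b)))
            (map-suc-applyUpTo (f ∘ suc) (suc b) k (λ i → trans (f≗b+ (suc i)) (ℕₚ.+-suc b i)))

map-suc-upTo : ∀ k → map suc (upTo k) ≡ interval 0 k
map-suc-upTo k = map-suc-applyUpTo (λ i → i) 0 k (λ _ → refl)

IsPerm⇒↭interval : ∀ {σ} → IsPerm σ → σ ↭ interval 0 (length σ)
IsPerm⇒↭interval {σ} = subst (σ ↭_) (map-suc-upTo (length σ))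

↭interval⇒IsPerm : ∀ {σ} → σ ↭ interval 0 (length σ) → IsPerm σ
↭interval⇒IsPerm {σ} = subst (σ ↭_) (sym (map-suc-upTo (length σ)))

length-interval : ∀ b k → length (interval b k) ≡ k
length-interval b zero    = refl
length-interval b (suc k) = cong suc (length-interval (suc b) k)

interval-++ : ∀ b m n → interval b (m + n) ≡ interval b m ++ interval (b + m) n
interval-++ b zero    n = cong (λ c → interval c n) (sym (ℕₚ.+-identityʳ b))
interval-++ b (suc m) n =
  cong (suc b ∷_) (trans (interval-++ (suc b) m n) (cong (λ c → interval (suc b) m ++ interval c n) (sym (ℕₚ.+-suc b m))))

interval-shift : ∀ b k → interval b k ≡ map (b +_) (interval 0 k)
interval-shift b zero    = refl
interval-shift b (suc k) = cong₂ _∷_ (sym (trans (ℕₚ.+-suc b 0) (cong suc (ℕₚ.+-identityʳ b)))) (begin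
  interval (suc b) k               ≡⟨ interval-shift (suc b) k ⟩
  map (suc b +_) (interval 0 k)    ≡⟨ Listₚ.map-cong (λ x → sym (ℕₚ.+-suc b x)) (interval 0 k) ⟩
  map ((b +_) ∘ suc) (interval 0 k) ≡⟨ Listₚ.map-∘ (interval 0 k) ⟩
  map (b +_) (map suc (interval 0 k)) ≡⟨ cong (map (b +_)) (sym (interval-shift 1 k)) ⟩
  map (b +_) (interval 1 k)        ∎)
  where open ≡-Reasoning

interval-snoc : ∀ b k → interval b (suc k) ≡ interval b k ++ [ b + suc k ]
interval-snoc b k = begin
  interval b (suc k)          ≡⟨ cong (interval b) (ℕₚ.+-comm 1 k) ⟩
  interval b (k + 1)          ≡⟨ interval-++ b k 1 ⟩
  interval b k ++ [ suc (b + k) ] ≡⟨ cong (λ x → interval b k ++ [ x ]) (sym (ℕₚ.+-suc b k)) ⟩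
  interval b k ++ [ b + suc k ] ∎
  where open ≡-Reasoning

∈-interval⇒bounds : ∀ {x} b k → x ∈ interval b k → b < x × x ≤ b + k
∈-interval⇒bounds b (suc k) (here refl) =
  ℕₚ.≤-refl , ℕₚ.≤-trans (s≤s (ℕₚ.m≤m+n b k)) (ℕₚ.≤-reflexive (sym (ℕₚ.+-suc b k)))
∈-interval⇒bounds b (suc k) (there x∈) with ∈-interval⇒bounds (suc b) k x∈
... | b<x , x≤ = ℕₚ.<-trans (ℕₚ.n<1+n b) b<x , ℕₚ.≤-trans x≤ (ℕₚ.≤-reflexive (sym (ℕₚ.+-suc b k)))

All-interval : ∀ {P : Pred ℕ 0ℓ} b k → (∀ {x} → b < x → x ≤ b + k → P x) → All P (interval b k)
All-interval b k h = All.tabulate (λ x∈ → let b<x , x≤ = ∈-interval⇒bounds b k x∈ in h b<x x≤)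

All-↭interval : ∀ {P : Pred ℕ 0ℓ} {xs} b k → xs ↭ interval b k → (∀ {x} → b < x → x ≤ b + k → P x) → All P xs
All-↭interval b k p h = ↭ₚ.All-resp-↭ (↭-sym p) (All-interval b k h)

descending-bounds : ∀ b k → All (λ v → b < v × v ≤ b + k) (descending b k)
descending-bounds b zero    = []
descending-bounds b (suc k) =
  (ℕₚ.≤-trans (s≤s (ℕₚ.m≤m+n b k)) (ℕₚ.≤-reflexive (sym (ℕₚ.+-suc b k))) , ℕₚ.≤-refl) ∷
  All.map (λ (b<v , v≤) → b<v , ℕₚ.≤-trans v≤ (ℕₚ.+-monoʳ-≤ b (ℕₚ.n≤1+n k))) (descending-bounds b k)

descending-decreasing : ∀ b k → AllPairs _>_ (descending b k)
descending-decreasing b zero    = []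
descending-decreasing b (suc k) =
  All.map (λ (_ , v≤) → ℕₚ.≤-<-trans v≤ (ℕₚ.+-monoʳ-< b (ℕₚ.n<1+n k))) (descending-bounds b k) ∷ descending-decreasing b k

length-descending : ∀ b k → length (descending b k) ≡ k
length-descending b zero    = refl
length-descending b (suc k) = cong suc (length-descending b k)

descending-↭ : ∀ b k → descending b k ↭ interval b k
descending-↭ b zero    = ↭-refl
descending-↭ b (suc k) =
  ↭-trans (prep (b + suc k) (descending-↭ b k))
    (↭-trans (↭ₚ.++-comm [ b + suc k ] (interval b k)) (↭-reflexive (sym (interval-snoc b k))))

module _ {P : Pred ℕ 0ℓ} (P? : Decidable P) (P-downward : ∀ {x y} → x ≤ y → P y → P x) where

  filter-interval : ∀ b m → ∃ λ c →
    filter P? (interval b m) ≡ interval b c × filter (¬? ∘ P?) (interval b m) ≡ interval (b + c) (m ∸ c)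
  filter-interval b zero = 0 , refl , refl
  filter-interval b (suc m) with P? (suc b)
  ... | yes _ with filter-interval (suc b) m
  ...   | c , accepted , rejected =
    suc c , cong (suc b ∷_) accepted , trans rejected (cong (λ d → interval d (m ∸ c)) (sym (ℕₚ.+-suc b c)))
  filter-interval b (suc m) | no ¬P =
    0 , Listₚ.filter-none P? later∉P ,
    trans (cong (suc b ∷_) (Listₚ.filter-all (¬? ∘ P?) later∉P)) (cong (λ d → interval d (suc m)) (sym (ℕₚ.+-identityʳ b)))
    where
    later∉P : All (¬_ ∘ P) (interval (suc b) m)
    later∉P = All-interval (suc b) m λ b<x _ Px → ¬P (P-downward (ℕₚ.<⇒≤ b<x) Px)

↭interval-skew-split : ∀ b m xs ys → xs ++ ys ↭ interval b m → All (λ y → All (y <_) xs) ys →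
  ys ↭ interval b (length ys) × xs ↭ interval (b + length ys) (length xs)
↭interval-skew-split b m xs ys p ys<xs =
  subst (λ k → ys ↭ interval b k) (sym |ys|≡c) ys↭ ,
  subst₂ (λ d k → xs ↭ interval (b + d) k) (sym |ys|≡c) (sym |xs|≡m∸c) xs↭
  where
  P : Pred ℕ 0ℓ
  P v = ¬ All (_< v) ys
  P? : Decidable P
  P? v = ¬? (All.all? (_<? v) ys)
  P-downward : ∀ {x y} → x ≤ y → P y → P x
  P-downward x≤y Py ys<x = Py (All.map (λ y<x → ℕₚ.<-≤-trans y<x x≤y) ys<x)
  c : ℕ
  c = proj₁ (filter-interval P? P-downward b m)
  accepted : filter P? (interval b m) ≡ interval b c
  accepted = proj₁ (proj₂ (filter-interval P? P-downward b m))
  rejected : filter (¬? ∘ P?) (interval b m) ≡ interval (b + c) (m ∸ c)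
  rejected = proj₂ (proj₂ (filter-interval P? P-downward b m))
  xs∉P : All (¬_ ∘ P) xs
  xs∉P = All.tabulate λ x∈ ¬P → ¬P (All.map (λ y<xs → All.lookup y<xs x∈) ys<xs)
  ys∈P : All P ys
  ys∈P = All.tabulate λ y∈ ys<y → ℕₚ.<-irrefl refl (All.lookup ys<y y∈)
  filter-ys : filter P? (xs ++ ys) ≡ ys
  filter-ys = begin
    filter P? (xs ++ ys)           ≡⟨ Listₚ.filter-++ P? xs ys ⟩
    filter P? xs ++ filter P? ys   ≡⟨ cong₂ _++_ (Listₚ.filter-none P? xs∉P) (Listₚ.filter-all P? ys∈P) ⟩
    ys                             ∎
    where open ≡-Reasoning
  filter-xs : filter (¬? ∘ P?) (xs ++ ys) ≡ xs
  filter-xs = begin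
    filter (¬? ∘ P?) (xs ++ ys)                 ≡⟨ Listₚ.filter-++ (¬? ∘ P?) xs ys ⟩
    filter (¬? ∘ P?) xs ++ filter (¬? ∘ P?) ys  ≡⟨ cong₂ _++_ (Listₚ.filter-all (¬? ∘ P?) xs∉P)
                                                              (Listₚ.filter-none (¬? ∘ P?) (All.map (λ Py ¬Py → ¬Py Py) ys∈P)) ⟩
    xs ++ []                                    ≡⟨ Listₚ.++-identityʳ xs ⟩
    xs                                          ∎
    where open ≡-Reasoning
  ys↭ : ys ↭ interval b c
  ys↭ = ↭-trans (↭-reflexive (sym filter-ys)) (↭-trans (↭ₚ.filter-↭ P? p) (↭-reflexive accepted))
  xs↭ : xs ↭ interval (b + c) (m ∸ c)
  xs↭ = ↭-trans (↭-reflexive (sym filter-xs)) (↭-trans (↭ₚ.filter-↭ (¬? ∘ P?) p) (↭-reflexive rejected))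
  |ys|≡c : length ys ≡ c
  |ys|≡c = trans (↭ₚ.↭-length ys↭) (length-interval b c)
  |xs|≡m∸c : length xs ≡ m ∸ c
  |xs|≡m∸c = trans (↭ₚ.↭-length xs↭) (length-interval (b + c) (m ∸ c))

decreasing-↭interval⇒descending : ∀ b k xs → AllPairs _>_ xs → xs ↭ interval b k → xs ≡ descending b k
decreasing-↭interval⇒descending b k [] _ p with trans (sym (length-interval b k)) (sym (↭ₚ.↭-length p))
... | refl = refl
decreasing-↭interval⇒descending b k (x ∷ xs) (xs<x ∷ dec) p with trans (sym (length-interval b k)) (sym (↭ₚ.↭-length p))
... | refl with ↭interval-skew-split b k [ x ] xs p (All.map (_∷ []) xs<x)
... | xs↭ , x↭ = cong₂ _∷_ (trans (Listₚ.∷-injectiveˡ (↭ₚ.↭-singleton-inv x↭)) (sym (ℕₚ.+-suc b (length xs))))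
                           (decreasing-↭interval⇒descending b (length xs) xs dec xs↭)

↭-shifted-interval : ∀ b k xs → xs ↭ interval b k → ∃ λ α → xs ≡ map (b +_) α × α ↭ interval 0 k
↭-shifted-interval b k xs p with ↭ₚ.↭-map-inv (b +_) (↭-trans (↭-reflexive (sym (interval-shift b k))) (↭-sym p))
... | α , xs≡ , α↭ = α , xs≡ , ↭-sym α↭

rank : ℕ → List ℕ → ℕ
rank x w = length (filterᵇ (_<ᵇ x) w)

filterᵇ-∷ : ∀ (p : ℕ → Bool) x xs → filterᵇ p (x ∷ xs) ≡ (if p x then x ∷ filterᵇ p xs else filterᵇ p xs)
filterᵇ-∷ p x xs with p x
... | true  = refl
... | false = refl

+-<ᵇ-cancelˡ : ∀ c y a → (c + y <ᵇ c + a) ≡ (y <ᵇ a)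
+-<ᵇ-cancelˡ zero    y a = refl
+-<ᵇ-cancelˡ (suc c) y a = +-<ᵇ-cancelˡ c y a

rank-shift : ∀ c a w → rank (c + a) (map (c +_) w) ≡ rank a w
rank-shift c a [] = refl
rank-shift c a (y ∷ w)
  rewrite filterᵇ-∷ (_<ᵇ c + a) (c + y) (map (c +_) w) | filterᵇ-∷ (_<ᵇ a) y w | +-<ᵇ-cancelˡ c y a
  with y <ᵇ a
... | true  = cong suc (rank-shift c a w)
... | false = rank-shift c a w

st-shift : ∀ c α → st (map (c +_) α) ≡ st α
st-shift c α = trans (sym (Listₚ.map-∘ α)) (Listₚ.map-cong (λ a → cong suc (rank-shift c a α)) α)

rank-all : ∀ x w → All (_< x) w → rank x w ≡ length w
rank-all x w w<x = cong length (Listₚ.filter-all (T? ∘ (_<ᵇ x)) (All.map ℕₚ.<⇒<ᵇ w<x))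

rank-none : ∀ x w → All (λ y → ¬ y < x) w → rank x w ≡ 0
rank-none x w w≮x = cong length (Listₚ.filter-none (T? ∘ (_<ᵇ x)) (All.map (λ y≮x → y≮x ∘ ℕₚ.<ᵇ⇒< _ x) w≮x))

rank-interval : ∀ x k → x < k → rank (suc x) (interval 0 k) ≡ x
rank-interval x k x<k = begin
  rank (suc x) (interval 0 k)                                   ≡⟨ cong (rank (suc x)) split ⟩
  rank (suc x) (interval 0 x ++ interval x (k ∸ x))             ≡⟨ cong length (Listₚ.filter-++ (T? ∘ (_<ᵇ suc x)) (interval 0 x) _) ⟩
  length (filterᵇ _ (interval 0 x) ++ filterᵇ _ (interval x (k ∸ x))) ≡⟨ Listₚ.length-++ (filterᵇ (_<ᵇ suc x) (interval 0 x)) ⟩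
  rank (suc x) (interval 0 x) + rank (suc x) (interval x (k ∸ x)) ≡⟨ cong₂ _+_ below above ⟩
  x + 0                                                          ≡⟨ ℕₚ.+-identityʳ x ⟩
  x                                                              ∎
  where
  open ≡-Reasoning
  split : interval 0 k ≡ interval 0 x ++ interval x (k ∸ x)
  split = trans (cong (interval 0) (sym (ℕₚ.m+[n∸m]≡n (ℕₚ.<⇒≤ x<k)))) (interval-++ 0 x (k ∸ x))
  below : rank (suc x) (interval 0 x) ≡ x
  below = trans (rank-all (suc x) (interval 0 x) (All-interval 0 x λ _ y≤x → s≤s y≤x)) (length-interval 0 x)
  above : rank (suc x) (interval x (k ∸ x)) ≡ 0
  above = rank-none (suc x) _ (All-interval x (k ∸ x) λ x<y _ y<1+x → ℕₚ.<⇒≱ x<y (ℕₚ.≤-pred y<1+x))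

st-↭interval : ∀ k α → α ↭ interval 0 k → st α ≡ α
st-↭interval k α p = trans (Listₚ.map-cong-local (All.tabulate fixed)) (Listₚ.map-id α)
  where
  fixed : ∀ {x} → x ∈ α → suc (rank x α) ≡ x
  fixed {x} x∈ with ∈-interval⇒bounds 0 k (↭ₚ.∈-resp-↭ p x∈)
  fixed {suc x} x∈ | _ , x<k =
    cong suc (trans (↭ₚ.↭-length (↭ₚ.filter-↭ (T? ∘ (_<ᵇ suc x)) p)) (rank-interval x k x<k))

-- Skew sums of blocks

-- A block (L , α) is a run of L + 1 decreasing left-to-right minima followed by α raised above them.
-- A list of blocks stands for their skew sum: every block lies above all later ones.
Block : Set
Block = ℕ × Word

PermBlock : Block → Set
PermBlock (L , α) = α ↭ interval 0 (length α)

size : List Block → ℕ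
size []             = 0
size ((L , α) ∷ bs) = size bs + (suc L + length α)

raised : ℕ → ℕ → Word → Word
raised r L α = map ((r + suc L) +_) α

blockWord : ℕ → ℕ → Word → Word
blockWord r L α = descending r (suc L) ++ raised r L α

word : List Block → Word
word []             = []
word ((L , α) ∷ bs) = blockWord (size bs) L α ++ word bs

minima : List Block → Word
minima []             = []
minima ((L , α) ∷ bs) = descending (size bs) (suc L) ++ minima bs

#minima : List Block → ℕ
#minima []             = 0
#minima ((L , α) ∷ bs) = suc L + #minima bs

length-minima : ∀ bs → length (minima bs) ≡ #minima bs
length-minima []             = refl
length-minima ((L , α) ∷ bs) =
  trans (Listₚ.length-++ (descending (size bs) (suc L))) (cong₂ _+_ (length-descending (size bs) (suc L)) (length-minima bs))

length-blockWord : ∀ r L α → length (blockWord r L α) ≡ suc L + length α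
length-blockWord r L α =
  trans (Listₚ.length-++ (descending r (suc L))) (cong₂ _+_ (length-descending r (suc L)) (Listₚ.length-map _ α))

length-word : ∀ bs → length (word bs) ≡ size bs
length-word []             = refl
length-word ((L , α) ∷ bs) = begin
  length (blockWord (size bs) L α ++ word bs)            ≡⟨ Listₚ.length-++ (blockWord (size bs) L α) ⟩
  length (blockWord (size bs) L α) + length (word bs)    ≡⟨ cong₂ _+_ (length-blockWord (size bs) L α) (length-word bs) ⟩
  (suc L + length α) + size bs                           ≡⟨ ℕₚ.+-comm _ (size bs) ⟩
  size bs + (suc L + length α)                           ∎
  where open ≡-Reasoning

blockWord-↭ : ∀ r L α → PermBlock (L , α) → blockWord r L α ↭ interval r (suc L + length α)
blockWord-↭ r L α p = ↭-trans
  (↭ₚ.++⁺ (descending-↭ r (suc L))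
           (↭-trans (↭ₚ.map⁺ ((r + suc L) +_) p) (↭-reflexive (sym (interval-shift (r + suc L) (length α))))))
  (↭-reflexive (sym (interval-++ r (suc L) (length α))))

word-↭ : ∀ bs → All PermBlock bs → word bs ↭ interval 0 (size bs)
word-↭ []             []       = ↭-refl
word-↭ ((L , α) ∷ bs) (p ∷ ps) = ↭-trans (↭ₚ.++⁺ (blockWord-↭ (size bs) L α p) (word-↭ bs ps))
  (↭-trans (↭ₚ.++-comm (interval (size bs) (suc L + length α)) (interval 0 (size bs)))
           (↭-reflexive (sym (interval-++ 0 (size bs) _))))

word-IsPerm : ∀ bs → All PermBlock bs → IsPerm (word bs)
word-IsPerm bs ps = ↭interval⇒IsPerm (subst (λ k → word bs ↭ interval 0 k) (sym (length-word bs)) (word-↭ bs ps))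

PermBlock-bounds : ∀ {L α} → PermBlock (L , α) → All (λ a → 0 < a × a ≤ length α) α
PermBlock-bounds {L} {α} p = All.tabulate (λ a∈ → ∈-interval⇒bounds 0 (length α) (↭ₚ.∈-resp-↭ p a∈))

raised-above : ∀ r L {α} → All (0 <_) α → All (r + suc L <_) (raised r L α)
raised-above r L α>0 = Allₚ.map⁺ (All.map (ℕₚ.m<m+n (r + suc L)) α>0)

raised-bounded : ∀ r L {α} → PermBlock (L , α) → All (_≤ r + (suc L + length α)) (raised r L α)
raised-bounded r L {α} p = Allₚ.map⁺ (All.map (λ (_ , a≤) →
  ℕₚ.≤-trans (ℕₚ.+-monoʳ-≤ (r + suc L) a≤) (ℕₚ.≤-reflexive (ℕₚ.+-assoc r (suc L) (length α)))) (PermBlock-bounds {L} p))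

blockWord-above : ∀ r L {α} → PermBlock (L , α) → All (r <_) (blockWord r L α)
blockWord-above r L p = Allₚ.++⁺ (All.map proj₁ (descending-bounds r (suc L)))
  (All.map (ℕₚ.<-trans (ℕₚ.m<m+n r z<s)) (raised-above r L (All.map proj₁ (PermBlock-bounds {L} p))))

isLTRmin≡true : ∀ pre x → All (x <_) pre → isLTRmin pre x ≡ true
isLTRmin≡true []        x []             = refl
isLTRmin≡true (y ∷ pre) x (x<y ∷ x<pre) rewrite <⇒<ᵇ≡true x<y = isLTRmin≡true pre x x<pre

isLTRmin≡false : ∀ pre x {m} → m ∈ pre → m < x → isLTRmin pre x ≡ false
isLTRmin≡false (y ∷ pre) x (here refl) m<x rewrite ≮⇒<ᵇ≡false (ℕₚ.<⇒≯ m<x) = refl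
isLTRmin≡false (y ∷ pre) x (there m∈) m<x with x <ᵇ y
... | true  = isLTRmin≡false pre x m∈ m<x
... | false = refl

-- c is the number of minima before the first block, so the entries of α in (L , α) lie in cell (c + 1 , c + L + 1)
blockLabels : ℕ → List Block → List (Maybe (ℕ × ℕ))
blockLabels c []             = []
blockLabels c ((L , α) ∷ bs) =
  replicate (suc L) nothing ++ replicate (length α) (just (suc c , c + suc L)) ++ blockLabels (c + suc L) bs

cellLabels′-descending : ∀ ms c pre r k rest → All (r + k <_) pre →
  cellLabels′ ms c pre (descending r k ++ rest) ≡ replicate k nothing ++ cellLabels′ ms (c + k) (pre ++ descending r k) rest
cellLabels′-descending ms c pre r zero    rest _ rewrite Listₚ.++-identityʳ pre | ℕₚ.+-identityʳ c = refl
cellLabels′-descending ms c pre r (suc k) rest pre>r+1+k rewrite isLTRmin≡true pre (r + suc k) pre>r+1+k =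
  cong (nothing ∷_) (trans
    (cellLabels′-descending ms (suc c) (pre ++ [ r + suc k ]) r k rest
      (Allₚ.++⁺ (All.map (ℕₚ.<-trans r+k<r+1+k) pre>r+1+k) (r+k<r+1+k ∷ [])))
    (cong₂ (λ d pre′ → replicate k nothing ++ cellLabels′ ms d pre′ rest)
      (sym (ℕₚ.+-suc c k)) (Listₚ.++-assoc pre [ r + suc k ] (descending r k))))
  where
  r+k<r+1+k : r + k < r + suc k
  r+k<r+1+k = ℕₚ.+-monoʳ-< r (ℕₚ.n<1+n k)

cellLabels′-above : ∀ ms c i pre {m} A rest → m ∈ pre → All (m <_) A → All (λ x → firstBelow ms x ≡ i) A →
  cellLabels′ ms c pre (A ++ rest) ≡ replicate (length A) (just (i , c)) ++ cellLabels′ ms c (pre ++ A) rest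
cellLabels′-above ms c i pre []      rest _  _ _ rewrite Listₚ.++-identityʳ pre = refl
cellLabels′-above ms c i pre (x ∷ A) rest m∈ (m<x ∷ m<A) (x↦i ∷ A↦i) rewrite isLTRmin≡false pre x m∈ m<x | x↦i =
  cong (just (i , c) ∷_) (trans
    (cellLabels′-above ms c i (pre ++ [ x ]) A rest (∈ₚ.∈-++⁺ˡ m∈) m<A A↦i)
    (cong (λ pre′ → replicate (length A) (just (i , c)) ++ cellLabels′ ms c pre′ rest) (Listₚ.++-assoc pre [ x ] A)))

firstBelow-++ : ∀ us vs x → All (x <_) us → firstBelow (us ++ vs) x ≡ length us + firstBelow vs x
firstBelow-++ []       vs x []            = refl
firstBelow-++ (u ∷ us) vs x (x<u ∷ x<us) rewrite ≮⇒<ᵇ≡false (ℕₚ.<⇒≯ x<u) = cong suc (firstBelow-++ us vs x x<us)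

firstBelow-∷ : ∀ v vs x → v < x → firstBelow (v ∷ vs) x ≡ 1
firstBelow-∷ v vs x v<x rewrite <⇒<ᵇ≡true v<x = refl

-- ms′ holds the values of the c minima before the blocks, pre the entries before them
cellLabels′-word : ∀ ms′ pre c bs → All PermBlock bs → length ms′ ≡ c → All (size bs <_) ms′ → All (size bs <_) pre →
  cellLabels′ (ms′ ++ minima bs) c pre (word bs) ≡ blockLabels c bs
cellLabels′-word ms′ pre c []             []       _      _         _         = refl
cellLabels′-word ms′ pre c ((L , α) ∷ bs) (p ∷ ps) |ms′|≡c ms′>size pre>size = begin
  cellLabels′ ms c pre (blockWord r L α ++ word bs)
    ≡⟨ cong (cellLabels′ ms c pre) (Listₚ.++-assoc (descending r (suc L)) A (word bs)) ⟩
  cellLabels′ ms c pre (descending r (suc L) ++ (A ++ word bs))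
    ≡⟨ cellLabels′-descending ms c pre r (suc L) _ (All.map (ℕₚ.≤-<-trans size-blockʳ) pre>size) ⟩
  replicate (suc L) nothing ++ cellLabels′ ms (c + suc L) pre′ (A ++ word bs)
    ≡⟨ cong (replicate (suc L) nothing ++_)
         (cellLabels′-above ms (c + suc L) (suc c) pre′ A (word bs) (∈ₚ.∈-++⁺ʳ pre (here refl)) A>minima A↦row) ⟩
  replicate (suc L) nothing ++ replicate (length A) (just (suc c , c + suc L)) ++ cellLabels′ ms (c + suc L) (pre′ ++ A) (word bs)
    ≡⟨ cong₂ (λ k rest → replicate (suc L) nothing ++ replicate k (just (suc c , c + suc L)) ++ rest)
         (Listₚ.length-map ((r + suc L) +_) α) rest-labels ⟩
  blockLabels c ((L , α) ∷ bs) ∎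
  where
  open ≡-Reasoning
  r : ℕ
  r = size bs
  A : Word
  A = raised r L α
  ms : Word
  ms = ms′ ++ (descending r (suc L) ++ minima bs)
  pre′ : Word
  pre′ = pre ++ descending r (suc L)
  size-blockʳ : r + suc L ≤ r + (suc L + length α)
  size-blockʳ = ℕₚ.+-monoʳ-≤ r (ℕₚ.m≤m+n (suc L) (length α))
  A>minima : All (r + suc L <_) A
  A>minima = raised-above r L (All.map proj₁ (PermBlock-bounds {L} p))
  above-r : ∀ {xs} → All (r + (suc L + length α) <_) xs → All (r <_) xs
  above-r = All.map (ℕₚ.≤-<-trans (ℕₚ.m≤m+n r _))
  A↦row : All (λ x → firstBelow ms x ≡ suc c) A
  A↦row = All.zipWith (λ (ms′>x , r+1+L<x) → begin
      firstBelow ms _                                            ≡⟨ firstBelow-++ ms′ _ _ ms′>x ⟩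
      length ms′ + firstBelow (descending r (suc L) ++ minima bs) _
        ≡⟨ cong₂ _+_ |ms′|≡c (firstBelow-∷ (r + suc L) (descending r L ++ minima bs) _ r+1+L<x) ⟩
      c + 1                                                      ≡⟨ ℕₚ.+-comm c 1 ⟩
      suc c                                                      ∎)
    (All.map (λ x≤ → All.map (ℕₚ.≤-<-trans x≤) ms′>size) (raised-bounded r L p) , A>minima)
  rest-labels : cellLabels′ ms (c + suc L) (pre′ ++ A) (word bs) ≡ blockLabels (c + suc L) bs
  rest-labels = trans
    (cong (λ ms″ → cellLabels′ ms″ (c + suc L) (pre′ ++ A) (word bs)) (sym (Listₚ.++-assoc ms′ (descending r (suc L)) (minima bs))))
    (cellLabels′-word (ms′ ++ descending r (suc L)) (pre′ ++ A) (c + suc L) bs ps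
      (trans (Listₚ.length-++ ms′) (cong₂ _+_ |ms′|≡c (length-descending r (suc L))))
      (Allₚ.++⁺ (above-r ms′>size) (All.map proj₁ (descending-bounds r (suc L))))
      (Allₚ.++⁺ (Allₚ.++⁺ (above-r pre>size) (All.map proj₁ (descending-bounds r (suc L))))
                (All.map (ℕₚ.≤-<-trans (ℕₚ.m≤m+n r (suc L))) A>minima)))

select : ∀ {X Y : Set} → (X → Bool) → List X → List Y → List Y
select f xs ys = map proj₂ (filterᵇ (f ∘ proj₁) (zip xs ys))

select-++ : ∀ {X Y : Set} (f : X → Bool) xs xs′ (ys ys′ : List Y) → length xs ≡ length ys →
  select f (xs ++ xs′) (ys ++ ys′) ≡ select f xs ys ++ select f xs′ ys′
select-++ f []       xs′ []       ys′ _ = refl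
select-++ f (x ∷ xs) xs′ (y ∷ ys) ys′ |xs|≡|ys| with f x
... | true  = cong (y ∷_) (select-++ f xs xs′ ys ys′ (ℕₚ.suc-injective |xs|≡|ys|))
... | false = select-++ f xs xs′ ys ys′ (ℕₚ.suc-injective |xs|≡|ys|)

select-replicate : ∀ {X Y : Set} (f : X → Bool) x k (ys : List Y) → k ≡ length ys →
  select f (replicate k x) ys ≡ (if f x then ys else [])
select-replicate f x zero    []       _ with f x
... | true  = refl
... | false = refl
select-replicate f x (suc k) (y ∷ ys) k≡ with f x in fx
... | true  = cong (y ∷_) (trans (select-replicate f x k ys (ℕₚ.suc-injective k≡)) (cong (λ b → if b then ys else []) fx))
... | false = trans (select-replicate f x k ys (ℕₚ.suc-injective k≡)) (cong (λ b → if b then ys else []) fx)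

select-map : ∀ {X X′ Y : Set} (f : X′ → Bool) (g : X → X′) xs (ys : List Y) → select f (map g xs) ys ≡ select (f ∘ g) xs ys
select-map f g []       ys       = refl
select-map f g (x ∷ xs) []       = refl
select-map f g (x ∷ xs) (y ∷ ys) with f (g x)
... | true  = cong (y ∷_) (select-map f g xs ys)
... | false = select-map f g xs ys

selectBlocks : (Maybe (ℕ × ℕ) → Bool) → ℕ → List Block → Word
selectBlocks f c []             = []
selectBlocks f c ((L , α) ∷ bs) =
  (if f nothing then descending (size bs) (suc L) else []) ++
  (if f (just (suc c , c + suc L)) then raised (size bs) L α else []) ++ selectBlocks f (c + suc L) bs

select-word : ∀ f c bs → select f (blockLabels c bs) (word bs) ≡ selectBlocks f c bs
select-word f c []             = refl
select-word f c ((L , α) ∷ bs) = begin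
  select f (replicate (suc L) nothing ++ ℓ) (blockWord r L α ++ word bs)
    ≡⟨ cong (select f (replicate (suc L) nothing ++ ℓ)) (Listₚ.++-assoc (descending r (suc L)) A (word bs)) ⟩
  select f (replicate (suc L) nothing ++ ℓ) (descending r (suc L) ++ A ++ word bs)
    ≡⟨ select-++ f (replicate (suc L) nothing) _ (descending r (suc L)) _
         (trans (Listₚ.length-replicate (suc L)) (sym (length-descending r (suc L)))) ⟩
  select f (replicate (suc L) nothing) (descending r (suc L)) ++ select f ℓ (A ++ word bs)
    ≡⟨ cong₂ _++_ (select-replicate f nothing (suc L) (descending r (suc L)) (sym (length-descending r (suc L))))
         (select-++ f (replicate (length α) cell) _ A _ (trans (Listₚ.length-replicate (length α)) (sym (Listₚ.length-map _ α)))) ⟩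
  (if f nothing then descending r (suc L) else []) ++
    select f (replicate (length α) cell) A ++ select f (blockLabels (c + suc L) bs) (word bs)
    ≡⟨ cong₂ (λ u v → (if f nothing then descending r (suc L) else []) ++ u ++ v)
         (select-replicate f cell (length α) A (sym (Listₚ.length-map _ α))) (select-word f (c + suc L) bs) ⟩
  selectBlocks f c ((L , α) ∷ bs) ∎
  where
  open ≡-Reasoning
  r : ℕ
  r = size bs
  A : Word
  A = raised r L α
  cell : Maybe (ℕ × ℕ)
  cell = just (suc c , c + suc L)
  ℓ : List (Maybe (ℕ × ℕ))
  ℓ = replicate (length α) cell ++ blockLabels (c + suc L) bs

ltrFlags′≡is-nothing : ∀ ms c pre xs → ltrFlags′ pre xs ≡ map is-nothing (cellLabels′ ms c pre xs)
ltrFlags′≡is-nothing ms c pre []       = refl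
ltrFlags′≡is-nothing ms c pre (x ∷ xs) with isLTRmin pre x
... | true  = cong (true ∷_) (ltrFlags′≡is-nothing ms (suc c) (pre ++ [ x ]) xs)
... | false = cong (false ∷_) (ltrFlags′≡is-nothing ms c (pre ++ [ x ]) xs)

selectBlocks-is-nothing : ∀ c bs → selectBlocks is-nothing c bs ≡ minima bs
selectBlocks-is-nothing c []             = refl
selectBlocks-is-nothing c ((L , α) ∷ bs) = cong (descending (size bs) (suc L) ++_) (selectBlocks-is-nothing (c + suc L) bs)

ltrMinValues-word : ∀ bs → All PermBlock bs → ltrMinValues (word bs) ≡ minima bs
ltrMinValues-word bs ps = begin
  select (λ b → b) (ltrFlags′ [] (word bs)) (word bs)
    ≡⟨ cong (λ fl → select (λ b → b) fl (word bs)) (ltrFlags′≡is-nothing (minima bs) 0 [] (word bs)) ⟩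
  select (λ b → b) (map is-nothing (cellLabels′ (minima bs) 0 [] (word bs))) (word bs)
    ≡⟨ cong (λ ℓ → select (λ b → b) (map is-nothing ℓ) (word bs)) (cellLabels′-word [] [] 0 bs ps refl [] []) ⟩
  select (λ b → b) (map is-nothing (blockLabels 0 bs)) (word bs)
    ≡⟨ select-map (λ b → b) is-nothing (blockLabels 0 bs) (word bs) ⟩
  select is-nothing (blockLabels 0 bs) (word bs)
    ≡⟨ select-word is-nothing 0 bs ⟩
  selectBlocks is-nothing 0 bs
    ≡⟨ selectBlocks-is-nothing 0 bs ⟩
  minima bs ∎
  where open ≡-Reasoning

ltrCount-word : ∀ bs → All PermBlock bs → ltrCount (word bs) ≡ #minima bs
ltrCount-word bs ps = trans (cong length (ltrMinValues-word bs ps)) (length-minima bs)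

cellLabels-word : ∀ bs → All PermBlock bs → cellLabels (word bs) ≡ blockLabels 0 bs
cellLabels-word bs ps =
  trans (cong (λ ms → cellLabels′ ms 0 [] (word bs)) (ltrMinValues-word bs ps)) (cellLabels′-word [] [] 0 bs ps refl [] [])

atCorner : ℕ → ℕ → ℕ → ℕ → Bool
atCorner c L i j = isCell i j (just (suc c , c + suc L))

blockCell : ℕ → List Block → Filling
blockCell c []             i j = []
blockCell c ((L , α) ∷ bs) i j = if atCorner c L i j then α else blockCell (c + suc L) bs i j

atCorner-above : ∀ c L i j → i ≤ c → atCorner c L i j ≡ false
atCorner-above c L i j i≤c
  rewrite ≢⇒≡ᵇ≡false {i} {suc c} (λ i≡1+c → ℕₚ.<⇒≱ (ℕₚ.n<1+n c) (subst (_≤ c) i≡1+c i≤c)) = refl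

selectBlocks-above : ∀ c bs i j → i ≤ c → selectBlocks (isCell i j) c bs ≡ []
selectBlocks-above c []             i j _   = refl
selectBlocks-above c ((L , α) ∷ bs) i j i≤c rewrite atCorner-above c L i j i≤c =
  selectBlocks-above (c + suc L) bs i j (ℕₚ.≤-trans i≤c (ℕₚ.m≤m+n c (suc L)))

blockCell-above : ∀ c bs i j → i ≤ c → blockCell c bs i j ≡ []
blockCell-above c []             i j _   = refl
blockCell-above c ((L , α) ∷ bs) i j i≤c rewrite atCorner-above c L i j i≤c =
  blockCell-above (c + suc L) bs i j (ℕₚ.≤-trans i≤c (ℕₚ.m≤m+n c (suc L)))

atCorner⇒≡ : ∀ {c L i j} → atCorner c L i j ≡ true → i ≡ suc c × j ≡ c + suc L
atCorner⇒≡ {c} {L} {i} {j} eq with ∧≡true⇒ {i ≡ᵇ suc c} eq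
... | i≡ , j≡ = ≡ᵇ≡true⇒≡ i≡ , ≡ᵇ≡true⇒≡ j≡

1+c≤c+1+L : ∀ c L → suc c ≤ c + suc L
1+c≤c+1+L c L = ℕₚ.≤-trans (ℕₚ.≤-reflexive (trans (cong suc (sym (ℕₚ.+-identityʳ c))) (sym (ℕₚ.+-suc c 0))))
                           (ℕₚ.+-monoʳ-≤ c (s≤s z≤n))

st-selectBlocks : ∀ c bs i j → All PermBlock bs → st (selectBlocks (isCell i j) c bs) ≡ blockCell c bs i j
st-selectBlocks c []             i j []       = refl
st-selectBlocks c ((L , α) ∷ bs) i j (p ∷ ps) with atCorner c L i j in corner
... | false = st-selectBlocks (c + suc L) bs i j ps
... | true  = begin
  st (raised (size bs) L α ++ selectBlocks (isCell i j) (c + suc L) bs)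
    ≡⟨ cong (λ rest → st (raised (size bs) L α ++ rest)) (selectBlocks-above (c + suc L) bs i j i≤c+1+L) ⟩
  st (raised (size bs) L α ++ [])   ≡⟨ cong st (Listₚ.++-identityʳ _) ⟩
  st (raised (size bs) L α)         ≡⟨ st-shift (size bs + suc L) α ⟩
  st α                              ≡⟨ st-↭interval (length α) α p ⟩
  α                                 ∎
  where
  open ≡-Reasoning
  i≤c+1+L : i ≤ c + suc L
  i≤c+1+L = subst (_≤ c + suc L) (sym (proj₁ (atCorner⇒≡ {c} {L} {i} {j} corner))) (1+c≤c+1+L c L)

SE-word : ∀ bs → All PermBlock bs → ∀ i j → SE (word bs) i j ≡ blockCell 0 bs i j
SE-word bs ps i j = begin
  st (select (isCell i j) (cellLabels (word bs)) (word bs))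
    ≡⟨ cong (λ ℓ → st (select (isCell i j) ℓ (word bs))) (cellLabels-word bs ps) ⟩
  st (select (isCell i j) (blockLabels 0 bs) (word bs))       ≡⟨ cong st (select-word (isCell i j) 0 bs) ⟩
  st (selectBlocks (isCell i j) 0 bs)                         ≡⟨ st-selectBlocks 0 bs i j ps ⟩
  blockCell 0 bs i j                                          ∎
  where open ≡-Reasoning

-- Fillings by blocks

-- an empty block is a single minimum, which makes the block list determined by its filling
Normal : Block → Set
Normal (L , α) = α ≡ [] → L ≡ 0

InTail : ℕ → ℕ → ℕ → ℕ → Set
InTail c n i j = suc c ≤ i × i ≤ j × j ≤ c + n

InTail⇒InB : ∀ {N c n i j} → c + n ≤ N → InTail c n i j → InB N i j
InTail⇒InB c+n≤N (1+c≤i , i≤j , j≤c+n) = ℕₚ.≤-trans (s≤s z≤n) 1+c≤i , i≤j , ℕₚ.≤-trans j≤c+n c+n≤N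

atCorner-corner : ∀ c L → atCorner c L (suc c) (c + suc L) ≡ true
atCorner-corner c L rewrite ≡ᵇ-refl c | ≡ᵇ-refl (c + suc L) = refl

blockCell-corner : ∀ c L α bs → blockCell c ((L , α) ∷ bs) (suc c) (c + suc L) ≡ α
blockCell-corner c L α bs rewrite atCorner-corner c L = refl

blockCell-off-corner : ∀ c L α bs i j → ¬ (i ≡ suc c × j ≡ c + suc L) → i ≤ c + suc L → blockCell c ((L , α) ∷ bs) i j ≡ []
blockCell-off-corner c L α bs i j off i≤ with atCorner c L i j in corner
... | true  = ⊥-elim (off (atCorner⇒≡ {c} {L} {i} {j} corner))
... | false = blockCell-above (c + suc L) bs i j i≤

blockCell-later : ∀ c L α bs i j → suc c < i → blockCell c ((L , α) ∷ bs) i j ≡ blockCell (c + suc L) bs i j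
blockCell-later c L α bs i j 1+c<i with atCorner c L i j in corner
... | true  = ⊥-elim (ℕₚ.<-irrefl (sym (proj₁ (atCorner⇒≡ {c} {L} {i} {j} corner))) 1+c<i)
... | false = refl

blockCell-first-row : ∀ c L α bs L′ → L ≢ L′ → blockCell c ((L′ , α) ∷ bs) (suc c) (c + suc L) ≡ []
blockCell-first-row c L α bs L′ L≢L′ =
  blockCell-off-corner c L′ α bs (suc c) (c + suc L)
    (λ (_ , eq) → L≢L′ (ℕₚ.suc-injective (ℕₚ.+-cancelˡ-≡ c _ _ eq))) (1+c≤c+1+L c L′)

head-injective : ∀ c L α bs L′ α′ bs′ → Normal (L , α) → Normal (L′ , α′) →
  blockCell c ((L , α) ∷ bs) (suc c) (c + suc L)  ≡ blockCell c ((L′ , α′) ∷ bs′) (suc c) (c + suc L) →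
  blockCell c ((L , α) ∷ bs) (suc c) (c + suc L′) ≡ blockCell c ((L′ , α′) ∷ bs′) (suc c) (c + suc L′) →
  L ≡ L′ × α ≡ α′
head-injective c L []      bs L′ []       bs′ nα nα′ _ _ = trans (nα refl) (sym (nα′ refl)) , refl
head-injective c L (a ∷ α) bs L′ α′ bs′ _ _ same-L _ with L ≟ L′
... | yes refl = refl , trans (sym (blockCell-corner c L (a ∷ α) bs)) (trans same-L (blockCell-corner c L α′ bs′))
... | no L≢L′ with () ← trans (sym (blockCell-corner c L (a ∷ α) bs)) (trans same-L (blockCell-first-row c L α′ bs′ L′ L≢L′))
head-injective c L [] bs L′ (a ∷ α′) bs′ _ _ same-L same-L′ with L ≟ L′
... | yes refl with () ← trans (sym (blockCell-corner c L (a ∷ α′) bs′)) (trans (sym same-L) (blockCell-corner c L [] bs))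
... | no L≢L′
  with () ← trans (sym (blockCell-corner c L′ (a ∷ α′) bs′)) (trans (sym same-L′) (blockCell-first-row c L′ [] bs L (L≢L′ ∘ sym)))

blockCell-injective : ∀ c bs bs′ → All Normal bs → All Normal bs′ → #minima bs ≡ #minima bs′ →
  (∀ i j → InTail c (#minima bs) i j → blockCell c bs i j ≡ blockCell c bs′ i j) → bs ≡ bs′
blockCell-injective c [] [] _ _ _ _ = refl
blockCell-injective c ((L , α) ∷ bs) ((L′ , α′) ∷ bs′) (nα ∷ ns) (nα′ ∷ ns′) same-n same
  with head-injective c L α bs L′ α′ bs′ nα nα′ (same _ _ corner) (same _ _ corner′)
  where
  corner : InTail c (suc L + #minima bs) (suc c) (c + suc L)
  corner = ℕₚ.≤-refl , 1+c≤c+1+L c L , ℕₚ.+-monoʳ-≤ c (ℕₚ.m≤m+n (suc L) (#minima bs))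
  corner′ : InTail c (suc L + #minima bs) (suc c) (c + suc L′)
  corner′ = ℕₚ.≤-refl , 1+c≤c+1+L c L′ ,
            ℕₚ.≤-trans (ℕₚ.+-monoʳ-≤ c (ℕₚ.m≤m+n (suc L′) (#minima bs′))) (ℕₚ.≤-reflexive (cong (c +_) (sym same-n)))
... | refl , refl = cong ((L , α) ∷_) (blockCell-injective (c + suc L) bs bs′ ns ns′ (ℕₚ.+-cancelˡ-≡ (suc L) _ _ same-n) same-tail)
  where
  same-tail : ∀ i j → InTail (c + suc L) (#minima bs) i j → blockCell (c + suc L) bs i j ≡ blockCell (c + suc L) bs′ i j
  same-tail i j (c+1+L<i , i≤j , j≤) = begin
    blockCell (c + suc L) bs i j            ≡⟨ blockCell-later c L α bs i j 1+c<i ⟨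
    blockCell c ((L , α) ∷ bs) i j
      ≡⟨ same i j (ℕₚ.<⇒≤ 1+c<i , i≤j , ℕₚ.≤-trans j≤ (ℕₚ.≤-reflexive (ℕₚ.+-assoc c (suc L) (#minima bs)))) ⟩
    blockCell c ((L , α) ∷ bs′) i j         ≡⟨ blockCell-later c L α bs′ i j 1+c<i ⟩
    blockCell (c + suc L) bs′ i j           ∎
    where
    open ≡-Reasoning
    1+c<i : suc c < i
    1+c<i = ℕₚ.<-≤-trans (s≤s (1+c≤c+1+L c L)) c+1+L<i

nonempty-blockCell : ∀ c L α bs i j → blockCell c ((L , α) ∷ bs) i j ≢ [] →
  (i ≡ suc c × j ≡ c + suc L) ⊎ (c + suc L < i × blockCell (c + suc L) bs i j ≢ [])
nonempty-blockCell c L α bs i j nonempty with atCorner c L i j in corner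
... | true  = inj₁ (atCorner⇒≡ {c} {L} {i} {j} corner)
... | false with ℕₚ.≤-<-connex i (c + suc L)
...   | inj₁ i≤ = ⊥-elim (nonempty (blockCell-above (c + suc L) bs i j i≤))
...   | inj₂ <i = inj₂ (<i , nonempty)

nonempty-blockCells-separated : ∀ c bs i j k ℓ → blockCell c bs i j ≢ [] → blockCell c bs k ℓ ≢ [] →
  (i ≡ k × j ≡ ℓ) ⊎ (j < k ⊎ ℓ < i)
nonempty-blockCells-separated c []             i j k ℓ nonempty _ = ⊥-elim (nonempty refl)
nonempty-blockCells-separated c ((L , α) ∷ bs) i j k ℓ nonempty nonempty′
  with nonempty-blockCell c L α bs i j nonempty | nonempty-blockCell c L α bs k ℓ nonempty′
... | inj₁ (refl , refl) | inj₁ (refl , refl) = inj₁ (refl , refl)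
... | inj₁ (refl , refl) | inj₂ (j<k , _)     = inj₂ (inj₁ j<k)
... | inj₂ (ℓ<i , _)     | inj₁ (refl , refl) = inj₂ (inj₂ ℓ<i)
... | inj₂ (_ , ne)      | inj₂ (_ , ne′)     = nonempty-blockCells-separated (c + suc L) bs i j k ℓ ne ne′

cell-≢-sym : ∀ {i j k ℓ : ℕ} → ¬ (i ≡ k × j ≡ ℓ) → ¬ (k ≡ i × ℓ ≡ j)
cell-≢-sym distinct (k≡i , ℓ≡j) = distinct (sym k≡i , sym ℓ≡j)

UDRC-sym : ∀ N i j k ℓ → UDRC N i j k ℓ → UDRC N k ℓ i j
UDRC-sym N i j k ℓ (distinct , inj₁ (inj₁ up))                 = cell-≢-sym distinct , inj₁ (inj₂ up)
UDRC-sym N i j k ℓ (distinct , inj₁ (inj₂ up))                 = cell-≢-sym distinct , inj₁ (inj₁ up)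
UDRC-sym N i j k ℓ (distinct , inj₂ (inj₁ (inj₁ down)))        = cell-≢-sym distinct , inj₂ (inj₁ (inj₂ down))
UDRC-sym N i j k ℓ (distinct , inj₂ (inj₁ (inj₂ down)))        = cell-≢-sym distinct , inj₂ (inj₁ (inj₁ down))
UDRC-sym N i j k ℓ (distinct , inj₂ (inj₂ (inj₁ same-row)))    = cell-≢-sym distinct , inj₂ (inj₂ (inj₁ (sym same-row)))
UDRC-sym N i j k ℓ (distinct , inj₂ (inj₂ (inj₂ same-column))) = cell-≢-sym distinct , inj₂ (inj₂ (inj₂ (sym same-column)))

separated⇒¬UDRC : ∀ N i j k ℓ → InB N i j → InB N k ℓ → j < k → ¬ UDRC N i j k ℓ
separated⇒¬UDRC N i j k ℓ (_ , i≤j , _) (_ , k≤ℓ , _) j<k (_ , adjacent) with adjacent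
... | inj₁ (inj₁ (k<i , _))             = ℕₚ.<-asym k<i (ℕₚ.≤-<-trans i≤j j<k)
... | inj₁ (inj₂ (_ , ℓ<j))             = ℕₚ.<-irrefl refl (ℕₚ.<-≤-trans (ℕₚ.<-trans ℓ<j j<k) k≤ℓ)
... | inj₂ (inj₁ (inj₁ (i<k , j<ℓ , rect))) =
  ℕₚ.<⇒≱ j<k (proj₁ (proj₂ (rect k j (ℕₚ.<⇒≤ i<k) ℕₚ.≤-refl ℕₚ.≤-refl (ℕₚ.<⇒≤ j<ℓ))))
... | inj₂ (inj₁ (inj₂ (k<i , _)))     = ℕₚ.<-asym k<i (ℕₚ.≤-<-trans i≤j j<k)
... | inj₂ (inj₂ (inj₁ refl))           = ℕₚ.<⇒≱ j<k i≤j
... | inj₂ (inj₂ (inj₂ refl))           = ℕₚ.<⇒≱ j<k k≤ℓ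

blockCell-independent : ∀ N c bs i j k ℓ → InB N i j → InB N k ℓ →
  blockCell c bs i j ≢ [] → blockCell c bs k ℓ ≢ [] → ¬ UDRC N i j k ℓ
blockCell-independent N c bs i j k ℓ ij∈B kℓ∈B nonempty nonempty′ adjacent
  with nonempty-blockCells-separated c bs i j k ℓ nonempty nonempty′
... | inj₁ (refl , refl) = proj₁ adjacent (refl , refl)
... | inj₂ (inj₁ j<k)    = separated⇒¬UDRC N i j k ℓ ij∈B kℓ∈B j<k adjacent
... | inj₂ (inj₂ ℓ<i)    = separated⇒¬UDRC N k ℓ i j kℓ∈B ij∈B ℓ<i (UDRC-sym N i j k ℓ adjacent)

blockCell-contents : ∀ {Q : Word → Set} c bs i j → All (Q ∘ proj₂) bs → blockCell c bs i j ≡ [] ⊎ Q (blockCell c bs i j)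
blockCell-contents c []             i j []       = inj₁ refl
blockCell-contents c ((L , α) ∷ bs) i j (q ∷ qs) with atCorner c L i j
... | true  = inj₂ q
... | false = blockCell-contents (c + suc L) bs i j qs

UDRC-corner : ∀ N c L i j → suc c ≤ i → i ≤ c + suc L → j ≤ N → ¬ (i ≡ suc c × j ≡ c + suc L) →
  UDRC N i j (suc c) (c + suc L)
UDRC-corner N c L i j 1+c≤i i≤ j≤N off-corner with ℕₚ.m≤n⇒m<n∨m≡n 1+c≤i
... | inj₂ refl = off-corner , inj₂ (inj₂ (inj₁ refl))
... | inj₁ 1+c<i with ℕₚ.<-cmp j (c + suc L)
...   | tri< j< _ _ = off-corner , inj₁ (inj₁ (1+c<i , j<))
...   | tri≈ _ j≡ _ = off-corner , inj₂ (inj₂ (inj₂ j≡))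
...   | tri> _ _ >j = off-corner , inj₂ (inj₁ (inj₂ (1+c<i , >j , rectangle)))
  where
  rectangle : RectIn N (suc c) (c + suc L) i j
  rectangle a b 1+c≤a a≤i c+1+L≤b b≤j =
    ℕₚ.≤-trans (s≤s z≤n) 1+c≤a , ℕₚ.≤-trans a≤i (ℕₚ.≤-trans i≤ c+1+L≤b) , ℕₚ.≤-trans b≤j j≤N

empty? : (w : Word) → Dec (w ≡ [])
empty? []      = yes refl
empty? (_ ∷ _) = no λ ()

EmptyOr : (Word → Set) → Block → Set
EmptyOr Q (L , α) = α ≡ [] ⊎ Q α

c+1+L+[n∸L]≡c+1+n : ∀ c {L n} → L ≤ n → c + suc L + (n ∸ L) ≡ c + suc n
c+1+L+[n∸L]≡c+1+n c {L} {n} L≤n = trans (ℕₚ.+-assoc c (suc L) (n ∸ L)) (cong (λ m → c + suc m) (ℕₚ.m+[n∸m]≡n L≤n))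

module _ (Q : Word → Set) (N : ℕ) (F : Filling)
         (F-contents : ∀ i j → InB N i j → F i j ≢ [] → Q (F i j))
         (F-independent : ∀ i j k ℓ → InB N i j → InB N k ℓ → F i j ≢ [] → F k ℓ ≢ [] → ¬ UDRC N i j k ℓ) where

  -- fuel ≥ n only serves termination
  blocksOf : ∀ fuel n c → n ≤ fuel → c + n ≤ N → ∃ λ bs →
    #minima bs ≡ n × All Normal bs × All (EmptyOr Q) bs × (∀ i j → InTail c n i j → blockCell c bs i j ≡ F i j)
  blocksOf fuel zero c _ _ =
    [] , refl , [] , [] ,
    λ i j (1+c≤i , i≤j , j≤c+0) → ⊥-elim (ℕₚ.<⇒≱ 1+c≤i (ℕₚ.≤-trans i≤j (ℕₚ.≤-trans j≤c+0 (ℕₚ.≤-reflexive (ℕₚ.+-identityʳ c)))))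
  blocksOf (suc fuel) (suc n) c (s≤s n≤fuel) c+1+n≤N
    with ℕₚ.anyUpTo? (λ L → ¬? (empty? (F (suc c) (c + suc L)))) (suc n)
  ... | yes (L , s≤s L≤n , nonempty) with blocksOf fuel (n ∸ L) (c + suc L) (ℕₚ.≤-trans (ℕₚ.m∸n≤m n L) n≤fuel)
                                             (ℕₚ.≤-trans (ℕₚ.≤-reflexive (c+1+L+[n∸L]≡c+1+n c L≤n)) c+1+n≤N)
  ...   | bs , #bs , normal , contents , cells =
    (L , F (suc c) (c + suc L)) ∷ bs , trans (cong (suc L +_) #bs) (cong suc (ℕₚ.m+[n∸m]≡n L≤n)) ,
    (λ empty → ⊥-elim (nonempty empty)) ∷ normal , inj₂ (F-contents _ _ (InTail⇒InB c+1+n≤N corner∈) nonempty) ∷ contents ,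
    cells′
    where
    corner∈ : InTail c (suc n) (suc c) (c + suc L)
    corner∈ = ℕₚ.≤-refl , 1+c≤c+1+L c L , ℕₚ.+-monoʳ-≤ c (s≤s L≤n)
    cells′ : ∀ i j → InTail c (suc n) i j → blockCell c ((L , F (suc c) (c + suc L)) ∷ bs) i j ≡ F i j
    cells′ i j ij∈@(1+c≤i , i≤j , j≤c+1+n) with ℕₚ.≤-<-connex i (c + suc L)
    ... | inj₂ c+1+L<i = trans (blockCell-later c L _ bs i j (ℕₚ.<-≤-trans (s≤s (1+c≤c+1+L c L)) c+1+L<i))
                               (cells i j (c+1+L<i , i≤j ,
                                           ℕₚ.≤-trans j≤c+1+n (ℕₚ.≤-reflexive (sym (c+1+L+[n∸L]≡c+1+n c L≤n)))))
    ... | inj₁ i≤c+1+L with (i ≟ suc c) ×-dec (j ≟ c + suc L)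
    ...   | yes (refl , refl) = blockCell-corner c L _ bs
    ...   | no off-corner = trans (blockCell-off-corner c L _ bs i j off-corner i≤c+1+L) (sym (decidable-stable (empty? (F i j)) λ nonempty′ →
            F-independent i j (suc c) (c + suc L) (InTail⇒InB c+1+n≤N ij∈) (InTail⇒InB c+1+n≤N corner∈) nonempty′ nonempty
              (UDRC-corner N c L i j 1+c≤i i≤c+1+L (ℕₚ.≤-trans j≤c+1+n c+1+n≤N) off-corner)))
  blocksOf (suc fuel) (suc n) c (s≤s n≤fuel) c+1+n≤N | no none
    with blocksOf fuel n (c + 1) n≤fuel (ℕₚ.≤-trans (ℕₚ.≤-reflexive (ℕₚ.+-assoc c 1 n)) c+1+n≤N)
  ... | bs , #bs , normal , contents , cells = (0 , []) ∷ bs , cong suc #bs , (λ _ → refl) ∷ normal , inj₁ refl ∷ contents , cells′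
    where
    cells′ : ∀ i j → InTail c (suc n) i j → blockCell c ((0 , []) ∷ bs) i j ≡ F i j
    cells′ i j (1+c≤i , i≤j , j≤c+1+n) with ℕₚ.m≤n⇒m<n∨m≡n 1+c≤i
    ... | inj₁ 1+c<i = trans (blockCell-later c 0 [] bs i j 1+c<i)
                             (cells i j (ℕₚ.≤-trans (ℕₚ.≤-reflexive (cong suc (ℕₚ.+-comm c 1))) 1+c<i , i≤j ,
                                         ℕₚ.≤-trans j≤c+1+n (ℕₚ.≤-reflexive (sym (ℕₚ.+-assoc c 1 n)))))
    ... | inj₂ refl = trans first-row (sym (decidable-stable (empty? (F (suc c) j)) λ nonempty →
                        none (j ∸ suc c , j∸1+c<1+n , subst (λ j′ → F (suc c) j′ ≢ []) j≡ nonempty)))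
      where
      j≡ : j ≡ c + suc (j ∸ suc c)
      j≡ = sym (trans (ℕₚ.+-suc c (j ∸ suc c)) (ℕₚ.m+[n∸m]≡n i≤j))
      j∸1+c<1+n : j ∸ suc c < suc n
      j∸1+c<1+n = ℕₚ.≤-trans (ℕₚ.≤-reflexive (sym (ℕₚ.+-∸-assoc 1 i≤j)))
                    (ℕₚ.≤-trans (ℕₚ.∸-monoˡ-≤ (suc c) (s≤s j≤c+1+n)) (ℕₚ.≤-reflexive (ℕₚ.m+n∸m≡n (suc c) (suc n))))
      first-row : blockCell c ((0 , []) ∷ bs) (suc c) j ≡ []
      first-row with atCorner c 0 (suc c) j
      ... | true  = refl
      ... | false = blockCell-above (c + 1) bs (suc c) j (ℕₚ.≤-reflexive (ℕₚ.+-comm 1 c))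

-- Pattern containment

Aligned : ℕ → ℕ → ℕ → ℕ → Set
Aligned a b x y = ((x < a) ⇔ (y < b)) × ((a < x) ⇔ (b < y))

aligned-above : ∀ {a b x y} → a < x → b < y → Aligned a b x y
aligned-above a<x b<y = mk⇔ (λ x<a → ⊥-elim (ℕₚ.<-asym x<a a<x)) (λ y<b → ⊥-elim (ℕₚ.<-asym y<b b<y)) ,
                        mk⇔ (λ _ → b<y) (λ _ → a<x)

aligned-below : ∀ {a b x y} → x < a → y < b → Aligned a b x y
aligned-below x<a y<b = mk⇔ (λ _ → y<b) (λ _ → x<a) ,
                        mk⇔ (λ a<x → ⊥-elim (ℕₚ.<-asym x<a a<x)) (λ b<y → ⊥-elim (ℕₚ.<-asym y<b b<y))

Aligned-sym : ∀ {a b x y} → Aligned a b x y → Aligned b a y x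
Aligned-sym (below , above) = ⇔.sym below , ⇔.sym above

OrderEmbedding : (ℕ → ℕ) → Set
OrderEmbedding f = ∀ {x y} → (x < y) ⇔ (f x < f y)

+-orderEmbedding : ∀ k → OrderEmbedding (k +_)
+-orderEmbedding k = mk⇔ (ℕₚ.+-monoʳ-< k) (ℕₚ.+-cancelˡ-< k _ _)

SameOrder-length : ∀ {u v} → SameOrder u v → length u ≡ length v
SameOrder-length []       = refl
SameOrder-length (_ ∷ so) = cong suc (SameOrder-length so)

SameOrder-sym : ∀ {u v} → SameOrder u v → SameOrder v u
SameOrder-sym []        = []
SameOrder-sym (ps ∷ so) = Pointwise.symmetric Aligned-sym ps ∷ SameOrder-sym so

module _ {f : ℕ → ℕ} (embedding : OrderEmbedding f) where

  Aligned-map⁺ : ∀ {a b x y} → Aligned a b x y → Aligned (f a) b (f x) y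
  Aligned-map⁺ (below , above) = ⇔.trans (⇔.sym embedding) below , ⇔.trans (⇔.sym embedding) above

  Aligned-map⁻ : ∀ {a b x y} → Aligned (f a) b (f x) y → Aligned a b x y
  Aligned-map⁻ (below , above) = ⇔.trans embedding below , ⇔.trans embedding above

  SameOrder-map⁺ : ∀ {u v} → SameOrder u v → SameOrder (map f u) v
  SameOrder-map⁺ []        = []
  SameOrder-map⁺ (ps ∷ so) = aligned ps ∷ SameOrder-map⁺ so
    where
    aligned : ∀ {a b u v} → Pointwise (Aligned a b) u v → Pointwise (Aligned (f a) b) (map f u) v
    aligned []       = []
    aligned (p ∷ ps) = Aligned-map⁺ p ∷ aligned ps

  SameOrder-map⁻ : ∀ u {v} → SameOrder (map f u) v → SameOrder u v
  SameOrder-map⁻ []      []        = []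
  SameOrder-map⁻ (x ∷ u) (ps ∷ so) = aligned u ps ∷ SameOrder-map⁻ u so
    where
    aligned : ∀ {a b} u {v} → Pointwise (Aligned (f a) b) (map f u) v → Pointwise (Aligned a b) u v
    aligned []      []       = []
    aligned (x ∷ u) (p ∷ ps) = Aligned-map⁻ p ∷ aligned u ps

SameOrder-map⁺ʳ : ∀ {f} → OrderEmbedding f → ∀ {u v} → SameOrder u v → SameOrder u (map f v)
SameOrder-map⁺ʳ embedding = SameOrder-sym ∘ SameOrder-map⁺ embedding ∘ SameOrder-sym

SameOrder-map⁻ʳ : ∀ {f} → OrderEmbedding f → ∀ {u} v → SameOrder u (map f v) → SameOrder u v
SameOrder-map⁻ʳ embedding v = SameOrder-sym ∘ SameOrder-map⁻ embedding v ∘ SameOrder-sym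

Pointwise-++⁻ : ∀ {R : ℕ → ℕ → Set} xs ys us vs → length xs ≡ length us → Pointwise R (xs ++ ys) (us ++ vs) →
  Pointwise R xs us × Pointwise R ys vs
Pointwise-++⁻ []       ys []       vs _ ps       = [] , ps
Pointwise-++⁻ (x ∷ xs) ys (u ∷ us) vs |xs|≡|us| (p ∷ ps) with Pointwise-++⁻ xs ys us vs (ℕₚ.suc-injective |xs|≡|us|) ps
... | ps₁ , ps₂ = p ∷ ps₁ , ps₂

Pointwise-Aligned-below : ∀ {a b u v} → Pointwise (Aligned a b) u v → All (_< a) u → All (_< b) v
Pointwise-Aligned-below []                []      = []
Pointwise-Aligned-below ((below , _) ∷ ps) (x<a ∷ u<a) = Equivalence.to below x<a ∷ Pointwise-Aligned-below ps u<a

Pointwise-Aligned-above : ∀ {a b u v} → Pointwise (Aligned a b) u v → All (a <_) u → All (b <_) v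
Pointwise-Aligned-above []                []          = []
Pointwise-Aligned-above ((_ , above) ∷ ps) (a<x ∷ a<u) = Equivalence.to above a<x ∷ Pointwise-Aligned-above ps a<u

SameOrder-decreasing : ∀ {u v} → SameOrder u v → AllPairs _>_ u → AllPairs _>_ v
SameOrder-decreasing []        []            = []
SameOrder-decreasing (ps ∷ so) (u<x ∷ dec-u) = Pointwise-Aligned-below ps u<x ∷ SameOrder-decreasing so dec-u

module _ (_≺_ : ℕ → ℕ → Set) (Pointwise-Aligned : ∀ {a b u v} → Pointwise (Aligned a b) u v → All (_≺ a) u → All (_≺ b) v) where

  SameOrder-split : ∀ w₁ w₂ π → SameOrder (w₁ ++ w₂) π → All (λ x → All (_≺ x) w₂) w₁ →
    ∃₂ λ π₁ π₂ → π ≡ π₁ ++ π₂ × SameOrder w₁ π₁ × SameOrder w₂ π₂ × All (λ x → All (_≺ x) π₂) π₁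
  SameOrder-split []       w₂ π       so         _                = [] , π , refl , [] , so , []
  SameOrder-split (x ∷ w₁) w₂ (b ∷ π) (ps ∷ so) (w₂≺x ∷ w₂≺w₁) with SameOrder-split w₁ w₂ π so w₂≺w₁
  ... | π₁ , π₂ , refl , so₁ , so₂ , π₂≺π₁ with Pointwise-++⁻ w₁ w₂ π₁ π₂ (SameOrder-length so₁) ps
  ... | ps₁ , ps₂ = b ∷ π₁ , π₂ , refl , ps₁ ∷ so₁ , so₂ , Pointwise-Aligned ps₂ w₂≺x ∷ π₂≺π₁

skew-split : ∀ w₁ w₂ π → SameOrder (w₁ ++ w₂) π → All (λ x → All (_< x) w₂) w₁ →
  ∃₂ λ π₁ π₂ → π ≡ π₁ ++ π₂ × SameOrder w₁ π₁ × SameOrder w₂ π₂ × All (λ x → All (_< x) π₂) π₁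
skew-split = SameOrder-split _<_ Pointwise-Aligned-below

direct-split : ∀ w₁ w₂ π → SameOrder (w₁ ++ w₂) π → All (λ x → All (x <_) w₂) w₁ →
  ∃₂ λ π₁ π₂ → π ≡ π₁ ++ π₂ × SameOrder w₁ π₁ × SameOrder w₂ π₂ × All (λ x → All (x <_) π₂) π₁
direct-split = SameOrder-split _>_ Pointwise-Aligned-above

⊆-++-split : ∀ {w : Word} xs ys → w ⊆ xs ++ ys → ∃₂ λ w₁ w₂ → w ≡ w₁ ++ w₂ × w₁ ⊆ xs × w₂ ⊆ ys
⊆-++-split []       ys w⊆ = [] , _ , refl , [] , w⊆
⊆-++-split (x ∷ xs) ys (.x ∷ʳ w⊆) with ⊆-++-split xs ys w⊆
... | w₁ , w₂ , refl , w₁⊆ , w₂⊆ = w₁ , w₂ , refl , x ∷ʳ w₁⊆ , w₂⊆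
⊆-++-split (x ∷ xs) ys (refl ∷ w⊆) with ⊆-++-split xs ys w⊆
... | w₁ , w₂ , refl , w₁⊆ , w₂⊆ = x ∷ w₁ , w₂ , refl , refl ∷ w₁⊆ , w₂⊆

⊆-map⁻ : ∀ (f : ℕ → ℕ) {w} xs → w ⊆ map f xs → ∃ λ w′ → w ≡ map f w′ × w′ ⊆ xs
⊆-map⁻ f []       []          = [] , refl , []
⊆-map⁻ f (x ∷ xs) (._ ∷ʳ w⊆) with ⊆-map⁻ f xs w⊆
... | w′ , refl , w′⊆ = w′ , refl , x ∷ʳ w′⊆
⊆-map⁻ f (x ∷ xs) (refl ∷ w⊆) with ⊆-map⁻ f xs w⊆
... | w′ , refl , w′⊆ = x ∷ w′ , refl , refl ∷ w′⊆

AllPairs-resp-⊆ : ∀ {R : ℕ → ℕ → Set} {w xs} → w ⊆ xs → AllPairs R xs → AllPairs R w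
AllPairs-resp-⊆ []          []        = []
AllPairs-resp-⊆ (_ ∷ʳ w⊆)   (_ ∷ rs)  = AllPairs-resp-⊆ w⊆ rs
AllPairs-resp-⊆ (refl ∷ w⊆) (r ∷ rs)  = ⊆ₚ.All-resp-⊆ w⊆ r ∷ AllPairs-resp-⊆ w⊆ rs

Contains-⊆ : ∀ {xs ys π} → xs ⊆ ys → Contains xs π → Contains ys π
Contains-⊆ xs⊆ys (w , w⊆xs , so) = w , ⊆-trans w⊆xs xs⊆ys , so

Contains-map⁺ : ∀ {f} → OrderEmbedding f → ∀ α π → Contains α π → Contains (map f α) π
Contains-map⁺ {f} embedding α π (w , w⊆ , so) = map f w , ⊆ₚ.map⁺ f w⊆ , SameOrder-map⁺ embedding so

Contains-map⁻ : ∀ {f} → OrderEmbedding f → ∀ α π → Contains (map f α) π → Contains α π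
Contains-map⁻ {f} embedding α π (w , w⊆ , so) with ⊆-map⁻ f α w⊆
... | w′ , refl , w′⊆ = w′ , w′⊆ , SameOrder-map⁻ embedding w′ so

Contains-1⊕ : ∀ m w π → All (m <_) w → All (0 <_) π → Contains w π → Contains (m ∷ w) (1⊕ π)
Contains-1⊕ m w π m<w π>0 (u , u⊆ , so) =
  m ∷ u , refl ∷ u⊆ , below-all (⊆ₚ.All-resp-⊆ u⊆ m<w) π>0 (SameOrder-length so) ∷ SameOrder-map⁺ʳ (+-orderEmbedding 1) so
  where
  below-all : ∀ {u v} → All (m <_) u → All (0 <_) v → length u ≡ length v → Pointwise (Aligned m 1) u (map suc v)
  below-all {[]}    {[]}    []          []          _ = []
  below-all {_ ∷ _} {_ ∷ _} (m<x ∷ m<u) (0<y ∷ v>0) |u|≡|v| =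
    aligned-above m<x (s≤s 0<y) ∷ below-all m<u v>0 (ℕₚ.suc-injective |u|≡|v|)

Contains-1⊕⁻ : ∀ w π → Contains w (1⊕ π) → Contains w π
Contains-1⊕⁻ w π (x ∷ u , u⊆ , _ ∷ so) = u , ⊆-trans (x ∷ʳ ⊆-refl) u⊆ , SameOrder-map⁻ʳ (+-orderEmbedding 1) π so

_⊖?_ : (π₁ π₂ : Word) → Dec (All (λ x → All (_< x) π₂) π₁)
π₁ ⊖? π₂ = All.all? (λ x → All.all? (_<? x) π₂) π₁

_⊕?_ : (π₁ π₂ : Word) → Dec (All (λ x → All (x <_) π₂) π₁)
π₁ ⊕? π₂ = All.all? (λ x → All.all? (x <?_) π₂) π₁

SkewIndecomposable : Word → Set
SkewIndecomposable π = ∀ π₁ π₂ → π ≡ π₁ ++ π₂ → All (λ x → All (_< x) π₂) π₁ → π₁ ≡ [] ⊎ π₂ ≡ []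

NoDecreasingSummand : Word → Set
NoDecreasingSummand π = ∀ π₁ π₂ → π ≡ π₁ ++ π₂ → AllPairs _>_ π₁ → All (λ x → All (x <_) π₂) π₁ → π₁ ≡ []

module _ (a b c d : ℕ) where

  skew-indecomposable₄ :
    False ([ a ] ⊖? (b ∷ c ∷ d ∷ [])) → False ((a ∷ b ∷ []) ⊖? (c ∷ d ∷ [])) → False ((a ∷ b ∷ c ∷ []) ⊖? [ d ]) →
    SkewIndecomposable (a ∷ b ∷ c ∷ d ∷ [])
  skew-indecomposable₄ _  _  _  []                        _  refl _ = inj₁ refl
  skew-indecomposable₄ s₁ _  _  (_ ∷ [])                  _  refl s = ⊥-elim (toWitnessFalse s₁ s)
  skew-indecomposable₄ _  s₂ _  (_ ∷ _ ∷ [])              _  refl s = ⊥-elim (toWitnessFalse s₂ s)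
  skew-indecomposable₄ _  _  s₃ (_ ∷ _ ∷ _ ∷ [])          _  refl s = ⊥-elim (toWitnessFalse s₃ s)
  skew-indecomposable₄ _  _  _  (_ ∷ _ ∷ _ ∷ _ ∷ [])      [] refl _ = inj₂ refl
  skew-indecomposable₄ _  _  _  (_ ∷ _ ∷ _ ∷ _ ∷ _ ∷ _)   _  ()   _

  no-decreasing-summand₄ :
    False ([ a ] ⊕? (b ∷ c ∷ d ∷ [])) → False (allPairs? _>?_ (a ∷ b ∷ []) ×-dec ((a ∷ b ∷ []) ⊕? (c ∷ d ∷ []))) →
    False (allPairs? _>?_ (a ∷ b ∷ c ∷ [])) → False (allPairs? _>?_ (a ∷ b ∷ c ∷ d ∷ [])) →
    NoDecreasingSummand (a ∷ b ∷ c ∷ d ∷ [])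
  no-decreasing-summand₄ _  _  _  _  []                      _  refl _   _ = refl
  no-decreasing-summand₄ s₁ _  _  _  (_ ∷ [])                _  refl _   s = ⊥-elim (toWitnessFalse s₁ s)
  no-decreasing-summand₄ _  s₂ _  _  (_ ∷ _ ∷ [])            _  refl dec s = ⊥-elim (toWitnessFalse s₂ (dec , s))
  no-decreasing-summand₄ _  _  d₃ _  (_ ∷ _ ∷ _ ∷ [])        _  refl dec _ = ⊥-elim (toWitnessFalse d₃ dec)
  no-decreasing-summand₄ _  _  _  d₄ (_ ∷ _ ∷ _ ∷ _ ∷ [])    [] refl dec _ = ⊥-elim (toWitnessFalse d₄ dec)
  no-decreasing-summand₄ _  _  _  _  (_ ∷ _ ∷ _ ∷ _ ∷ _ ∷ _) _  ()   _   _

Basis4-skew-indecomposable : ∀ π → Basis4 π → SkewIndecomposable π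
Basis4-skew-indecomposable _ (inj₁ refl)                = skew-indecomposable₄ 2 4 1 3 _ _ _
Basis4-skew-indecomposable _ (inj₂ (inj₁ refl))         = skew-indecomposable₄ 3 1 4 2 _ _ _
Basis4-skew-indecomposable _ (inj₂ (inj₂ (inj₁ refl)))  = skew-indecomposable₄ 2 3 1 4 _ _ _
Basis4-skew-indecomposable _ (inj₂ (inj₂ (inj₂ refl)))  = skew-indecomposable₄ 3 1 2 4 _ _ _

Basis4-no-decreasing-summand : ∀ π → Basis4 π → NoDecreasingSummand π
Basis4-no-decreasing-summand _ (inj₁ refl)               = no-decreasing-summand₄ 2 4 1 3 _ _ _ _
Basis4-no-decreasing-summand _ (inj₂ (inj₁ refl))        = no-decreasing-summand₄ 3 1 4 2 _ _ _ _
Basis4-no-decreasing-summand _ (inj₂ (inj₂ (inj₁ refl))) = no-decreasing-summand₄ 2 3 1 4 _ _ _ _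
Basis4-no-decreasing-summand _ (inj₂ (inj₂ (inj₂ refl))) = no-decreasing-summand₄ 3 1 2 4 _ _ _ _

1⊕-skew-indecomposable : ∀ τ → SkewIndecomposable (1⊕ τ)
1⊕-skew-indecomposable τ []       _        _   _                  = inj₁ refl
1⊕-skew-indecomposable τ (_ ∷ _)  []       _   _                  = inj₂ refl
1⊕-skew-indecomposable τ (x ∷ π₁) (y ∷ π₂) eq ((y<x ∷ _) ∷ _) with Listₚ.∷-injective eq
... | refl , eq′ = ⊥-elim (no-zero τ π₁ eq′ y<x)
  where
  no-zero : ∀ τ π₁ → map suc τ ≡ π₁ ++ y ∷ π₂ → ¬ y < 1
  no-zero (t ∷ τ) []       refl (s≤s ())
  no-zero (t ∷ τ) (_ ∷ π₁) eq   = no-zero τ π₁ (Listₚ.∷-injectiveʳ eq)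

Avoids : PermSet → Word → Set
Avoids Q σ = ∀ π → Q π → ¬ Contains σ π

Avoids-⊆ : ∀ {Q w σ} → w ⊆ σ → Avoids Q σ → Avoids Q w
Avoids-⊆ w⊆σ avoids π Qπ = avoids π Qπ ∘ Contains-⊆ w⊆σ

SameOrder-[] : ∀ {w} → SameOrder w [] → w ≡ []
SameOrder-[] [] = refl

¬Basis4∪1⊕[] : ∀ {P} → ¬ (Basis4 ∪ 1⊕Set P) []
¬Basis4∪1⊕[] (inj₁ (inj₁ ()))
¬Basis4∪1⊕[] (inj₁ (inj₂ (inj₁ ())))
¬Basis4∪1⊕[] (inj₁ (inj₂ (inj₂ (inj₁ ()))))
¬Basis4∪1⊕[] (inj₁ (inj₂ (inj₂ (inj₂ ()))))
¬Basis4∪1⊕[] (inj₂ (_ , _ , ()))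

Basis4∪1⊕-skew-indecomposable : ∀ {P} π → (Basis4 ∪ 1⊕Set P) π → SkewIndecomposable π
Basis4∪1⊕-skew-indecomposable π (inj₁ basis)          = Basis4-skew-indecomposable π basis
Basis4∪1⊕-skew-indecomposable _ (inj₂ (τ , _ , refl)) = 1⊕-skew-indecomposable τ

skew-sum-avoids : ∀ {Q σ₁ σ₂} → (∀ π → Q π → SkewIndecomposable π) → All (λ x → All (_< x) σ₂) σ₁ →
  Avoids Q σ₁ → Avoids Q σ₂ → Avoids Q (σ₁ ++ σ₂)
skew-sum-avoids {σ₁ = σ₁} {σ₂} indecomposable σ₂<σ₁ avoids₁ avoids₂ π Qπ (w , w⊆ , so)
  with ⊆-++-split σ₁ σ₂ w⊆
... | w₁ , w₂ , refl , w₁⊆ , w₂⊆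
  with skew-split w₁ w₂ π so (⊆ₚ.All-resp-⊆ w₁⊆ (All.map (⊆ₚ.All-resp-⊆ w₂⊆) σ₂<σ₁))
... | π₁ , π₂ , refl , so₁ , so₂ , π₂<π₁ with indecomposable _ Qπ π₁ π₂ refl π₂<π₁
... | inj₁ refl with refl ← SameOrder-[] so₁ = avoids₂ π₂ Qπ (w₂ , w₂⊆ , so₂)
... | inj₂ refl = avoids₁ (π₁ ++ []) Qπ (w₁ , w₁⊆ , subst (SameOrder w₁) (sym (Listₚ.++-identityʳ π₁)) so₁)

head-map-suc-≮1 : ∀ {y ys} τ → y ∷ ys ≡ map suc τ → ¬ y < 1
head-map-suc-≮1 (t ∷ τ) eq y<1 = ℕₚ.<⇒≱ y<1 (subst (1 ≤_) (sym (Listₚ.∷-injectiveˡ eq)) (s≤s z≤n))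

module _ {P : PermSet} where

  blockWord-avoids : ∀ r L α → All (0 <_) α → Avoids (Basis4 ∪ P) α → Avoids (Basis4 ∪ 1⊕Set P) (blockWord r L α)
  blockWord-avoids r L α α>0 avoids π Qπ (w , w⊆ , so) with ⊆-++-split (descending r (suc L)) (raised r L α) w⊆
  ... | w₁ , w₂ , refl , w₁⊆ , w₂⊆ with direct-split w₁ w₂ π so w₁<w₂
    where
    w₁<w₂ : All (λ x → All (x <_) w₂) w₁
    w₁<w₂ = ⊆ₚ.All-resp-⊆ w₁⊆ (All.map (λ (_ , x≤) → All.map (ℕₚ.≤-<-trans x≤) (⊆ₚ.All-resp-⊆ w₂⊆ (raised-above r L α>0)))
                                       (descending-bounds r (suc L)))
  ... | π₁ , π₂ , refl , so₁ , so₂ , π₁<π₂ = occurs-in-α Qπ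
    where
    π₁-decreasing : AllPairs _>_ π₁
    π₁-decreasing = SameOrder-decreasing so₁ (AllPairs-resp-⊆ w₁⊆ (descending-decreasing r (suc L)))
    avoids-raised : Avoids (Basis4 ∪ P) (raised r L α)
    avoids-raised π′ Qπ′ = avoids π′ Qπ′ ∘ Contains-map⁻ (+-orderEmbedding (r + suc L)) α π′
    occurs-in-α : (Basis4 ∪ 1⊕Set P) (π₁ ++ π₂) → ⊥
    occurs-in-α (inj₁ basis) with refl ← Basis4-no-decreasing-summand _ basis π₁ π₂ refl π₁-decreasing π₁<π₂
                              with refl ← SameOrder-[] so₁ = avoids-raised π₂ (inj₁ basis) (w₂ , w₂⊆ , so₂)
    occurs-in-α (inj₂ (τ , Pτ , eq)) = by-prefix π₁ eq so₁ π₁-decreasing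
      where
      -- π₁ is a decreasing prefix of 1 ⊕ τ, so it is empty or the leading 1
      by-prefix : ∀ π₁ → π₁ ++ π₂ ≡ 1⊕ τ → SameOrder w₁ π₁ → AllPairs _>_ π₁ → ⊥
      by-prefix [] refl so₁ _ with refl ← SameOrder-[] so₁ =
        avoids-raised τ (inj₂ Pτ) (Contains-1⊕⁻ (raised r L α) τ (w₂ , w₂⊆ , so₂))
      by-prefix (_ ∷ []) eq _ _ with refl , refl ← Listₚ.∷-injective eq =
        avoids-raised τ (inj₂ Pτ) (w₂ , w₂⊆ , SameOrder-map⁻ʳ (+-orderEmbedding 1) τ so₂)
      by-prefix (_ ∷ _ ∷ π₁) eq _ ((y<x ∷ _) ∷ _) with refl , eq′ ← Listₚ.∷-injective eq = head-map-suc-≮1 τ eq′ y<x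

  word-avoids : ∀ bs → All PermBlock bs → All (Avoids (Basis4 ∪ P) ∘ proj₂) bs → Avoids (Basis4 ∪ 1⊕Set P) (word bs)
  word-avoids [] [] [] π Qπ ([] , [] , []) = ¬Basis4∪1⊕[] Qπ
  word-avoids ((L , α) ∷ bs) (p ∷ ps) (avoids ∷ avoids-bs) =
    skew-sum-avoids Basis4∪1⊕-skew-indecomposable word-bs<block
      (blockWord-avoids (size bs) L α (All.map proj₁ (PermBlock-bounds {L} p)) avoids) (word-avoids bs ps avoids-bs)
    where
    word-bs<block : All (λ x → All (_< x) (word bs)) (blockWord (size bs) L α)
    word-bs<block = All.map (λ size<x → All-↭interval 0 (size bs) (word-↭ bs ps) (λ _ y≤size → ℕₚ.≤-<-trans y≤size size<x))
                            (blockWord-above (size bs) L p)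

  -- a pattern τ ∈ P inside α becomes 1 ⊕ τ once the last minimum of its block is prepended
  blocks-avoid : (∀ π → P π → IsPerm π) → ∀ bs → All PermBlock bs → Avoids (Basis4 ∪ 1⊕Set P) (word bs) →
    All (Av (Basis4 ∪ P) ∘ proj₂) bs
  blocks-avoid P-perms []             []       _      = []
  blocks-avoid P-perms ((L , α) ∷ bs) (p ∷ ps) avoids =
    (↭interval⇒IsPerm p , α-avoids) ∷ blocks-avoid P-perms bs ps (Avoids-⊆ (⊆ₚ.++⁺ˡ (blockWord r L α) ⊆-refl) avoids)
    where
    r : ℕ
    r = size bs
    raised⊆ : raised r L α ⊆ word ((L , α) ∷ bs)
    raised⊆ = ⊆ₚ.++⁺ʳ (word bs) (⊆ₚ.++⁺ˡ (descending r (suc L)) ⊆-refl)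
    min∷raised⊆ : r + suc L ∷ raised r L α ⊆ word ((L , α) ∷ bs)
    min∷raised⊆ = ⊆ₚ.++⁺ʳ (word bs) (refl ∷ ⊆ₚ.++⁺ˡ (descending r L) ⊆-refl)
    positive : ∀ {β} → β ↭ interval 0 (length β) → All (0 <_) β
    positive {β} β↭ = All-↭interval 0 (length β) β↭ (λ 0<x _ → 0<x)
    α-avoids : Avoids (Basis4 ∪ P) α
    α-avoids π (inj₁ basis) = avoids π (inj₁ basis) ∘ Contains-⊆ raised⊆ ∘ Contains-map⁺ (+-orderEmbedding (r + suc L)) α π
    α-avoids π (inj₂ Pπ) = avoids (1⊕ π) (inj₂ (π , Pπ , refl)) ∘ Contains-⊆ min∷raised⊆
      ∘ Contains-1⊕ (r + suc L) (raised r L α) π (raised-above r L (positive p)) (positive (IsPerm⇒↭interval (P-perms π Pπ)))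
      ∘ Contains-map⁺ (+-orderEmbedding (r + suc L)) α π

-- Every permutation avoiding the basis is a word of blocks

interval-increasing : ∀ b k → AllPairs _<_ (interval b k)
interval-increasing b zero    = []
interval-increasing b (suc k) = All-interval (suc b) k (λ b+1<x _ → b+1<x) ∷ interval-increasing (suc b) k

↭interval⇒Unique : ∀ {σ} b k → σ ↭ interval b k → Unique σ
↭interval⇒Unique b k σ↭ =
  Unique-resp-↭ (↭⇒↭ₛ (↭-sym σ↭)) (AllPairs.map ℕₚ.<⇒≢ (interval-increasing b k))

≢∧≯⇒< : ∀ {x y} → x ≢ y → ¬ y < x → x < y
≢∧≯⇒< x≢y y≮x = ℕₚ.≤∧≢⇒< (ℕₚ.≮⇒≥ y≮x) x≢y

sameOrder₄ : ∀ {p q r s π₁ π₂ π₃ π₄} →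
  Aligned p π₁ q π₂ → Aligned p π₁ r π₃ → Aligned p π₁ s π₄ → Aligned q π₂ r π₃ → Aligned q π₂ s π₄ → Aligned r π₃ s π₄ →
  SameOrder (p ∷ q ∷ r ∷ s ∷ []) (π₁ ∷ π₂ ∷ π₃ ∷ π₄ ∷ [])
sameOrder₄ pq pr ps qr qs rs = (pq ∷ pr ∷ ps ∷ []) ∷ (qr ∷ qs ∷ []) ∷ (rs ∷ []) ∷ [] ∷ []

module _ {a b c d : ℕ} (avoids : Avoids Basis4 (a ∷ b ∷ c ∷ d ∷ [])) where

  ≮-2314-2413 : b ≢ d → a < b → c < a → ¬ a < d
  ≮-2314-2413 b≢d a<b c<a a<d with ℕₚ.<-cmp b d
  ... | tri< b<d _ _ = avoids _ (inj₂ (inj₂ (inj₁ refl))) (_ , ⊆-refl , sameOrder₄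
          (aligned-above a<b (<ᵇ≡true⇒< refl)) (aligned-below c<a (<ᵇ≡true⇒< refl)) (aligned-above a<d (<ᵇ≡true⇒< refl))
          (aligned-below (ℕₚ.<-trans c<a a<b) (<ᵇ≡true⇒< refl)) (aligned-above b<d (<ᵇ≡true⇒< refl))
          (aligned-above (ℕₚ.<-trans c<a a<d) (<ᵇ≡true⇒< refl)))
  ... | tri≈ _ b≡d _ = b≢d b≡d
  ... | tri> _ _ d<b = avoids _ (inj₁ refl) (_ , ⊆-refl , sameOrder₄
          (aligned-above a<b (<ᵇ≡true⇒< refl)) (aligned-below c<a (<ᵇ≡true⇒< refl)) (aligned-above a<d (<ᵇ≡true⇒< refl))
          (aligned-below (ℕₚ.<-trans c<a a<b) (<ᵇ≡true⇒< refl)) (aligned-below d<b (<ᵇ≡true⇒< refl))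
          (aligned-above (ℕₚ.<-trans c<a a<d) (<ᵇ≡true⇒< refl)))

  ≮-3124 : b < a → c < a → a < d → ¬ b < c
  ≮-3124 b<a c<a a<d b<c = avoids _ (inj₂ (inj₂ (inj₂ refl))) (_ , ⊆-refl , sameOrder₄
    (aligned-below b<a (<ᵇ≡true⇒< refl)) (aligned-below c<a (<ᵇ≡true⇒< refl)) (aligned-above a<d (<ᵇ≡true⇒< refl))
    (aligned-above b<c (<ᵇ≡true⇒< refl)) (aligned-above (ℕₚ.<-trans b<a a<d) (<ᵇ≡true⇒< refl))
    (aligned-above (ℕₚ.<-trans c<a a<d) (<ᵇ≡true⇒< refl)))

  ≮-3142 : b < a → a < c → d < a → ¬ b < d
  ≮-3142 b<a a<c d<a b<d = avoids _ (inj₂ (inj₁ refl)) (_ , ⊆-refl , sameOrder₄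
    (aligned-below b<a (<ᵇ≡true⇒< refl)) (aligned-above a<c (<ᵇ≡true⇒< refl)) (aligned-below d<a (<ᵇ≡true⇒< refl))
    (aligned-above (ℕₚ.<-trans b<a a<c) (<ᵇ≡true⇒< refl)) (aligned-above b<d (<ᵇ≡true⇒< refl))
    (aligned-below (ℕₚ.<-trans d<a a<c) (<ᵇ≡true⇒< refl)))

Decomposes : Word → Set
Decomposes σ = ∃ λ bs → σ ≡ word bs × All PermBlock bs × All Normal bs

span : ∀ {P : Pred ℕ 0ℓ} → Decidable P → ∀ τ →
  ∃₂ λ D rest → τ ≡ D ++ rest × All P D × (∀ {h rest′} → rest ≡ h ∷ rest′ → ¬ P h)
span P? []      = [] , [] , refl , [] , λ ()
span P? (x ∷ τ) with P? x
... | no ¬Px = [] , x ∷ τ , refl , [] , λ { refl → ¬Px }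
... | yes Px with span P? τ
...   | D , rest , refl , PD , stops = x ∷ D , rest , refl , Px ∷ PD , stops

decreasing-from-pairs : ∀ D → Unique D → (∀ {d y} → d ∷ y ∷ [] ⊆ D → ¬ d < y) → AllPairs _>_ D
decreasing-from-pairs []      _              _         = []
decreasing-from-pairs (d ∷ D) (d≢D ∷ unique) no-ascent =
  All.tabulate (λ y∈D → ≢∧≯⇒< (λ y≡d → All.lookup d≢D y∈D (sym y≡d)) (no-ascent (refl ∷ from∈ y∈D)))
  ∷ decreasing-from-pairs D unique (λ dy⊆D → no-ascent (d ∷ʳ dy⊆D))

-- a first entry above everything else is a block (0 , []) of its own
prepend-maximum : ∀ a D → a ∷ D ↭ interval 0 (suc (length D)) → All (_< a) D →
  (D ↭ interval 0 (length D) → Decomposes D) → Decomposes (a ∷ D)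
prepend-maximum a D σ↭ D<a decompose with ↭interval-skew-split 0 (suc (length D)) [ a ] D σ↭ (All.map (_∷ []) D<a)
... | D↭ , a↭ with decompose D↭
... | bs , refl , perms , normal = (0 , []) ∷ bs , cong (_∷ word bs) a≡ , ↭-refl ∷ perms , (λ _ → refl) ∷ normal
  where
  a≡ : a ≡ size bs + 1
  a≡ = trans (Listₚ.∷-injectiveˡ (↭ₚ.↭-singleton-inv a↭)) (trans (ℕₚ.+-comm 1 (length (word bs))) (cong (_+ 1) (length-word bs)))

prepend-block : ∀ a D g G′ R → a ∷ D ++ (g ∷ G′) ++ R ↭ interval 0 (length (a ∷ D ++ (g ∷ G′) ++ R)) →
  AllPairs _>_ (a ∷ D) → All (a <_) (g ∷ G′) → All (λ x → All (x <_) (a ∷ D ++ g ∷ G′)) R →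
  (R ↭ interval 0 (length R) → Decomposes R) → Decomposes (a ∷ D ++ (g ∷ G′) ++ R)
prepend-block a D g G′ R σ↭ (D<a ∷ D-decreasing) G>a R<rest decompose
  with ↭interval-skew-split 0 (length (a ∷ D ++ (g ∷ G′) ++ R)) (a ∷ D ++ g ∷ G′) R
         (subst (_↭ interval 0 (length (a ∷ D ++ (g ∷ G′) ++ R))) (cong (a ∷_) (sym (Listₚ.++-assoc D (g ∷ G′) R))) σ↭) R<rest
... | R↭ , X↭ with ↭interval-skew-split (length R) _ (g ∷ G′) (a ∷ D) (↭-trans (↭ₚ.++-comm (g ∷ G′) (a ∷ D)) X↭) aD<G
  where
  aD<G : All (λ y → All (y <_) (g ∷ G′)) (a ∷ D)
  aD<G = G>a ∷ All.map (λ d<a → All.map (ℕₚ.<-trans d<a) G>a) D<a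
... | aD↭ , G↭ with decreasing-↭interval⇒descending (length R) _ (a ∷ D) (D<a ∷ D-decreasing) aD↭
                  | ↭-shifted-interval _ _ (g ∷ G′) G↭ | decompose R↭
... | aD≡ | α , G≡ , α↭ | bs , refl , perms , normal =
  (length D , α) ∷ bs , σ≡ , subst (λ k → α ↭ interval 0 k) |G|≡|α| α↭ ∷ perms ,
  (λ α≡[] → contradiction (trans G≡ (cong (map _) α≡[])) λ ()) ∷ normal
  where
  |G|≡|α| : length (g ∷ G′) ≡ length α
  |G|≡|α| = trans (cong length G≡) (Listₚ.length-map _ α)
  σ≡ : a ∷ D ++ (g ∷ G′) ++ word bs ≡ word ((length D , α) ∷ bs)
  σ≡ = begin
    a ∷ D ++ (g ∷ G′) ++ word bs              ≡⟨ Listₚ.++-assoc (a ∷ D) (g ∷ G′) (word bs) ⟨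
    ((a ∷ D) ++ (g ∷ G′)) ++ word bs          ≡⟨ cong₂ (λ xs ys → (xs ++ ys) ++ word bs) aD≡ G≡ ⟩
    blockWord (length (word bs)) (length D) α ++ word bs ≡⟨ cong (λ r → blockWord r (length D) α ++ word bs) (length-word bs) ⟩
    word ((length D , α) ∷ bs)                ∎
    where open ≡-Reasoning

Unique⇒≢ : ∀ {x y σ} → Unique σ → x ∷ y ∷ [] ⊆ σ → x ≢ y
Unique⇒≢ unique xy⊆σ with AllPairs-resp-⊆ xy⊆σ unique
... | (x≢y ∷ []) ∷ _ = x≢y

-- once an entry after the ascent a < g is below a, the patterns 2314 and 2413 keep all later entries below a
after-ascent-below : ∀ {a g} D G′ R → Unique (a ∷ D ++ (g ∷ G′) ++ R) → Avoids Basis4 (a ∷ D ++ (g ∷ G′) ++ R) →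
  a < g → (∀ {h R′} → R ≡ h ∷ R′ → ¬ a < h) → All (_< a) R
after-ascent-below D G′ [] _ _ _ _ = []
after-ascent-below {a} {g} D G′ (h ∷ R) unique avoids a<g first≯a = h<a ∷ All.tabulate λ x∈R →
  ≢∧≯⇒< (λ x≡a → Unique⇒≢ unique (refl ∷ ⊆ₚ.++⁺ˡ D (g ∷ʳ ⊆ₚ.++⁺ˡ G′ (h ∷ʳ from∈ x∈R))) (sym x≡a))
    (≮-2314-2413 (Avoids-⊆ (refl ∷ ⊆ₚ.++⁺ˡ D (refl ∷ ⊆ₚ.++⁺ˡ G′ (refl ∷ from∈ x∈R))) avoids)
      (Unique⇒≢ unique (a ∷ʳ ⊆ₚ.++⁺ˡ D (refl ∷ ⊆ₚ.++⁺ˡ G′ (h ∷ʳ from∈ x∈R)))) a<g h<a)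
  where
  h<a : h < a
  h<a = ≢∧≯⇒< (λ h≡a → Unique⇒≢ unique (refl ∷ ⊆ₚ.++⁺ˡ D (g ∷ʳ ⊆ₚ.++⁺ˡ G′ (refl ∷ minimum R))) (sym h≡a))
              (first≯a refl)

-- an ascent d < y in D would form 3124 with a and g
before-ascent-decreasing : ∀ {a g} D G′ R → Unique (a ∷ D ++ (g ∷ G′) ++ R) → Avoids Basis4 (a ∷ D ++ (g ∷ G′) ++ R) →
  All (_< a) D → a < g → AllPairs _>_ D
before-ascent-decreasing {a} {g} D G′ R (_ ∷ unique) avoids D<a a<g =
  decreasing-from-pairs D (AllPairs-resp-⊆ (⊆ₚ.++⁺ʳ ((g ∷ G′) ++ R) ⊆-refl) unique) λ {d} {y} dy⊆D →
    ≮-3124 (Avoids-⊆ (refl ∷ ⊆ₚ.++⁺ dy⊆D (refl ∷ minimum (G′ ++ R))) avoids)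
      (All.head (⊆ₚ.All-resp-⊆ dy⊆D D<a)) (All.head (All.tail (⊆ₚ.All-resp-⊆ dy⊆D D<a))) a<g

-- an entry x of R above some d in D would form 3142 with a and g
after-ascent-below-D : ∀ {a g} D G′ R → Unique (a ∷ D ++ (g ∷ G′) ++ R) → Avoids Basis4 (a ∷ D ++ (g ∷ G′) ++ R) →
  All (_< a) D → a < g → All (_< a) R → All (λ x → All (x <_) D) R
after-ascent-below-D {a} {g} D G′ R unique avoids D<a a<g R<a = All.tabulate λ {x} x∈R → All.tabulate λ {d} d∈D →
  ≢∧≯⇒< (λ x≡d → Unique⇒≢ unique (a ∷ʳ ⊆ₚ.++⁺ (from∈ d∈D) (g ∷ʳ ⊆ₚ.++⁺ˡ G′ (from∈ x∈R))) (sym x≡d))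
    (≮-3142 (Avoids-⊆ (refl ∷ ⊆ₚ.++⁺ (from∈ d∈D) (refl ∷ ⊆ₚ.++⁺ˡ G′ (from∈ x∈R))) avoids)
      (All.lookup D<a d∈D) a<g (All.lookup R<a x∈R))

-- Split σ = a D G R where D (resp. G) is the longest run of entries below (resp. above) a; then a D is the run of
-- minima of the first block and G its raised part, or G = R = [] and a is a block of its own.
decomposition : ∀ k σ → length σ ≤ k → σ ↭ interval 0 (length σ) → Avoids Basis4 σ → Decomposes σ
decomposition k       []      _           _  _      = [] , refl , [] , []
decomposition (suc k) (a ∷ τ) (s≤s |τ|≤k) σ↭ avoids with span (_<? a) τ
... | D , rest , refl , D<a , rest≮a with span (a <?_) rest
... | [] , [] , refl , _ , _ rewrite Listₚ.++-identityʳ D =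
  prepend-maximum a D σ↭ D<a (λ D↭ → decomposition k D |τ|≤k D↭ (Avoids-⊆ (a ∷ʳ ⊆-refl) avoids))
... | [] , h ∷ R , refl , _ , R≯a with a≢h ∷ _ ← ↭interval⇒Unique 0 _ σ↭ =
  ⊥-elim (All.lookup a≢h (∈ₚ.∈-++⁺ʳ D (here refl)) (sym (ℕₚ.≤∧≮⇒≡ (ℕₚ.≮⇒≥ (R≯a refl)) (rest≮a refl))))
... | g ∷ G′ , R , refl , G>a , R≯a =
  prepend-block a D g G′ R σ↭ (D<a ∷ before-ascent-decreasing D G′ R unique avoids D<a a<g) G>a R<rest
    (λ R↭ → decomposition k R |R|≤k R↭ (Avoids-⊆ (a ∷ʳ ⊆ₚ.++⁺ˡ D (⊆ₚ.++⁺ˡ (g ∷ G′) ⊆-refl)) avoids))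
  where
  unique : Unique (a ∷ D ++ (g ∷ G′) ++ R)
  unique = ↭interval⇒Unique 0 _ σ↭
  a<g : a < g
  a<g = All.head G>a
  |R|≤k : length R ≤ k
  |R|≤k = ℕₚ.≤-trans (ℕₚ.≤-trans (Listₚ.length-++-≤ʳ R {g ∷ G′}) (Listₚ.length-++-≤ʳ _ {D})) |τ|≤k
  R<a : All (_< a) R
  R<a = after-ascent-below D G′ R unique avoids a<g R≯a
  R<rest : All (λ x → All (x <_) (a ∷ D ++ g ∷ G′)) R
  R<rest = All.zipWith (λ (x<a , x<D) → x<a ∷ Allₚ.++⁺ x<D (All.map (ℕₚ.<-trans x<a) G>a))
                       (R<a , after-ascent-below-D D G′ R unique avoids D<a a<g R<a)

Contains-[] : ∀ {π} → Contains [] π → π ≡ []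
Contains-[] (_ , [] , []) = refl

module _ (P : PermSet) (P-perms : ∀ π → P π → IsPerm π) (n : ℕ) where

  AvN⇒word : ∀ σ → AvN n (Basis4 ∪ 1⊕Set P) σ → ∃ λ bs →
    σ ≡ word bs × All PermBlock bs × All Normal bs × #minima bs ≡ n × All (Av (Basis4 ∪ P) ∘ proj₂) bs
  AvN⇒word σ ((σ-perm , avoids) , #σ)
    with decomposition (length σ) σ ℕₚ.≤-refl (IsPerm⇒↭interval σ-perm) (λ π basis → avoids π (inj₁ basis))
  ... | bs , refl , perms , normal =
    bs , refl , perms , normal , trans (sym (ltrCount-word bs perms)) #σ , blocks-avoid P-perms bs perms avoids

  SE-injective : ∀ σ τ → AvN n (Basis4 ∪ 1⊕Set P) σ → AvN n (Basis4 ∪ 1⊕Set P) τ → SE σ ≈[ n ] SE τ → σ ≡ τ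
  SE-injective σ τ σ∈ τ∈ same-SE with AvN⇒word σ σ∈ | AvN⇒word τ τ∈
  ... | bs , refl , perms , normal , #bs , _ | bs′ , refl , perms′ , normal′ , #bs′ , _ =
    cong word (blockCell-injective 0 bs bs′ normal normal′ (trans #bs (sym #bs′)) λ i j ij∈ → begin
      blockCell 0 bs i j    ≡⟨ SE-word bs perms i j ⟨
      SE (word bs) i j      ≡⟨ same-SE i j (subst (λ m → InTail 0 m i j) #bs ij∈) ⟩
      SE (word bs′) i j     ≡⟨ SE-word bs′ perms′ i j ⟩
      blockCell 0 bs′ i j   ∎)
    where open ≡-Reasoning

  SE-into : ∀ σ → AvN n (Basis4 ∪ 1⊕Set P) σ → WI n (UDRC n) (Av⁺ (Basis4 ∪ P)) (SE σ)
  SE-into σ σ∈ with AvN⇒word σ σ∈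
  ... | bs , refl , perms , _ , _ , avoid = contents , independent
    where
    contents : ∀ i j → InB n i j → SE (word bs) i j ≢ [] → Av⁺ (Basis4 ∪ P) (SE (word bs) i j)
    contents i j _ nonempty rewrite SE-word bs perms i j with blockCell-contents 0 bs i j avoid
    ... | inj₁ empty = ⊥-elim (nonempty empty)
    ... | inj₂ av    = av , nonempty
    independent : ∀ i j k ℓ → InB n i j → InB n k ℓ → SE (word bs) i j ≢ [] → SE (word bs) k ℓ ≢ [] → ¬ UDRC n i j k ℓ
    independent i j k ℓ rewrite SE-word bs perms i j | SE-word bs perms k ℓ = blockCell-independent n 0 bs i j k ℓ

  SE-onto : ¬ P [] → ∀ F → WI n (UDRC n) (Av⁺ (Basis4 ∪ P)) F → ∃ λ σ → AvN n (Basis4 ∪ 1⊕Set P) σ × SE σ ≈[ n ] F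
  SE-onto ¬P[] F (F-contents , F-independent)
    with blocksOf (Av⁺ (Basis4 ∪ P)) n F F-contents F-independent n n 0 ℕₚ.≤-refl ℕₚ.≤-refl
  ... | bs , #bs , _ , contents , cells =
    word bs , ((word-IsPerm bs perms , word-avoids {P} bs perms (All.map (λ {b} → avoid {b}) contents)) , trans (ltrCount-word bs perms) #bs) ,
    λ i j ij∈ → trans (SE-word bs perms i j) (cells i j ij∈)
    where
    perm : ∀ {b} → EmptyOr (Av⁺ (Basis4 ∪ P)) b → PermBlock b
    perm (inj₁ refl)            = ↭-refl
    perm (inj₂ ((α-perm , _) , _)) = IsPerm⇒↭interval α-perm
    perms : All PermBlock bs
    perms = All.map (λ {b} → perm {b}) contents
    avoid : ∀ {b} → EmptyOr (Av⁺ (Basis4 ∪ P)) b → Avoids (Basis4 ∪ P) (proj₂ b)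
    avoid (inj₁ refl) π (inj₁ basis) contains with refl ← Contains-[] contains = ¬Basis4∪1⊕[] {P} (inj₁ basis)
    avoid (inj₁ refl) π (inj₂ Pπ)    contains with refl ← Contains-[] contains = ¬P[] Pπ
    avoid (inj₂ ((_ , avoids) , _)) = avoids

theorem5p3 : (P : PermSet) → (∀ π → P π → IsPerm π) → ¬ P [] → (n : ℕ) →
    SEBijection n (AvN n (Basis4 ∪ 1⊕Set P)) (WI n (UDRC n) (Av⁺ (Basis4 ∪ P)))
theorem5p3 P P-perms ¬P[] n = SE-injective P P-perms n , SE-into P P-perms n , SE-onto P P-perms n ¬P[]
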